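{- Let $s$ be a natural number that is not a perfect square and let $i\in\{1,2\}$. Let $C_1,C_2:\mathbb{N}^2\to\mathbb{N}$ be the Cantor polynomials $C_1(x,y)=C_2(y,x)=\frac12(x+y)^2+\frac12(x+3y)$, which are bijections. Define $f:\mathbb{N}^2\to\mathbb{N}^2$ by $f(\bar a)=C_i^{ -1}(s\cdot C_i(\bar a))$. Then $f$ is not definable in $(\mathbb{N},+)$.
   Context: Definable means that the graph $\{(a_1,a_2,b_1,b_2)\mid f(a_1,a_2)=(b_1,b_2)\}$ is first-order definable without parameters in $(\mathbb{N},+)$. -}

module Defs where

open import Data.Nat using (ℕ; zero; suc; _+_; _*_)
open import Data.Nat.DivMod using (_/_)
open import Data.Fin using (Fin; zero; suc)
open import Data.Empty using (⊥)
open import Data.Product using (_×_; Σ; _,_)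
open import Relation.Binary.PropositionalEquality using (_≡_)
open import Function.Bundles using (_⇔_)

-- We use the classical
-- negative fragment (=, ⊥, ⇒, ∀); the other connectives (¬, ∧, ∨, ∃)
-- are classical abbreviations.  Interpreting this fragment in Agda
-- gives exactly classical Tarski semantics (every formula is ¬¬-stable).

data Term (n : ℕ) : Set where
  var  : Fin n → Term n
  _⊕_  : Term n → Term n → Term n

data Formula : ℕ → Set where
  _≐_  : ∀ {n} → Term n → Term n → Formula n
  ⊥'   : ∀ {n} → Formula n
  _⇒_  : ∀ {n} → Formula n → Formula n → Formula n
  all  : ∀ {n} → Formula (suc n) → Formula n

Env : ℕ → Set
Env n = Fin n → ℕ

extend : ∀ {n} → ℕ → Env n → Env (suc n)
extend a ρ zero    = a
extend a ρ (suc i) = ρ i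

evalT : ∀ {n} → Env n → Term n → ℕ
evalT ρ (var i) = ρ i
evalT ρ (t ⊕ u) = evalT ρ t + evalT ρ u

⟦_⟧ : ∀ {n} → Formula n → Env n → Set
⟦ t ≐ u ⟧ ρ = evalT ρ t ≡ evalT ρ u
⟦ ⊥' ⟧ ρ    = ⊥
⟦ φ ⇒ ψ ⟧ ρ = ⟦ φ ⟧ ρ → ⟦ ψ ⟧ ρ
⟦ all φ ⟧ ρ = (a : ℕ) → ⟦ φ ⟧ (extend a ρ)

env4 : ℕ → ℕ → ℕ → ℕ → Env 4
env4 a₁ a₂ b₁ b₂ zero                   = a₁
env4 a₁ a₂ b₁ b₂ (suc zero)             = a₂
env4 a₁ a₂ b₁ b₂ (suc (suc zero))       = b₁
env4 a₁ a₂ b₁ b₂ (suc (suc (suc zero))) = b₂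

Definable4 : (ℕ → ℕ → ℕ → ℕ → Set) → Set
Definable4 R = Σ (Formula 4) λ φ →
  ∀ a₁ a₂ b₁ b₂ → R a₁ a₂ b₁ b₂ ⇔ ⟦ φ ⟧ (env4 a₁ a₂ b₁ b₂)

C₁ : ℕ → ℕ → ℕ
C₁ x y = ((x + y) * (x + y) + x + 3 * y) / 2

C₂ : ℕ → ℕ → ℕ
C₂ x y = C₁ y x

-- index i ∈ {1,2} encoded as Fin 2 (zero ↦ 1, suc zero ↦ 2)
Cantor : Fin 2 → ℕ → ℕ → ℕ
Cantor zero       = C₁
Cantor (suc zero) = C₂

IsSquare : ℕ → Set
IsSquare s = Σ ℕ λ k → k * k ≡ s

-- Graph of f(ā) = C_i⁻¹(s · C_i(ā)):  f(a₁,a₂) = (b₁,b₂)  iff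
-- C_i(b₁,b₂) = s · C_i(a₁,a₂)  (C_i is a bijection ℕ² → ℕ).
GraphF : Fin 2 → ℕ → ℕ → ℕ → ℕ → ℕ → Set
GraphF i s a₁ a₂ b₁ b₂ = Cantor i b₁ b₂ ≡ s * Cantor i a₁ a₂

module Submission where

open import Defs
open import Data.Nat using (ℕ)
open import Data.Fin using (Fin)
open import Relation.Nullary using (¬_)

-- Presburger arithmetic cannot tell apart two tuples that are congruent modulo a large M and on
-- which every linear form with small coefficients either takes the same value or has the same sign
-- and a large absolute value: a back-and-forth argument, eliminating the new variable through a
-- pivot form, shows that every formula of bounded size and quantifier rank holds at both or at neither.
-- For non-square s write f (n , 0) = (m − r , r), where tri m + r = s · tri n. The numbers
-- X = 2m + 1 and Y = 2n + 1 satisfy X² − sY² = 1 − s − 8r, so a form αn + βm + kr with k ≠ 0 and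
-- small coefficients cannot be small at two nearby large n: the differences would satisfy
-- ΔX² = sΔY². Halving windows then gives one n at which all these forms are large. Now
-- (n , 0 , m − r , r) lies on the graph and (n , 0 , m − r + M , r − M) does not, yet no formula
-- separates them. Swapping variables reduces C₂ to C₁.

module IntegerBounds where

  open import Data.Nat as ℕ using (ℕ; zero; suc; s≤s)
  import Data.Nat.Properties as ℕₚ
  open import Data.Integer using (+_; -[1+_]; +<+; -≤+; -<-; -<+; ∣_∣; _+_; _*_; -_; _-_; _≤_; _<_; 0ℤ)
  open import Data.Integer.Properties
    using (∣i+j∣≤∣i∣+∣j∣; ∣i-j∣≤∣i∣+∣j∣; ∣i*j∣≡∣i∣*∣j∣; ≤-refl; [+m]-[+n]≡m⊖n; ⊖-≥)
  open import Relation.Binary.PropositionalEquality using (_≡_; trans)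

  ∣*∣-≤ : ∀ {A B} a b → ∣ a ∣ ℕ.≤ A → ∣ b ∣ ℕ.≤ B → ∣ a * b ∣ ℕ.≤ A ℕ.* B
  ∣*∣-≤ a b a≤ b≤ rewrite ∣i*j∣≡∣i∣*∣j∣ a b = ℕₚ.*-mono-≤ a≤ b≤

  ∣+∣-≤ : ∀ {A B} a b → ∣ a ∣ ℕ.≤ A → ∣ b ∣ ℕ.≤ B → ∣ a + b ∣ ℕ.≤ A ℕ.+ B
  ∣+∣-≤ a b a≤ b≤ = ℕₚ.≤-trans (∣i+j∣≤∣i∣+∣j∣ a b) (ℕₚ.+-mono-≤ a≤ b≤)

  ∣-∣-≤ : ∀ {A B} a b → ∣ a ∣ ℕ.≤ A → ∣ b ∣ ℕ.≤ B → ∣ a - b ∣ ℕ.≤ A ℕ.+ B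
  ∣-∣-≤ a b a≤ b≤ = ℕₚ.≤-trans (∣i-j∣≤∣i∣+∣j∣ a b) (ℕₚ.+-mono-≤ a≤ b≤)

  -∣i∣≤i : ∀ i → - + ∣ i ∣ ≤ i
  -∣i∣≤i (+ zero) = ≤-refl
  -∣i∣≤i (+ suc n) = -≤+
  -∣i∣≤i -[1+ n ] = ≤-refl

  +K<i : ∀ {K i} → 0ℤ ≤ i → K ℕ.< ∣ i ∣ → + K < i
  +K<i {i = + n} _ K<n = +<+ K<n

  i<-K : ∀ {K i} → i < 0ℤ → K ℕ.< ∣ i ∣ → i < - + K
  i<-K {i = + n} (+<+ ()) _
  i<-K {zero} { -[1+ n ]} _ _ = -<+
  i<-K {suc K} { -[1+ n ]} _ (s≤s K<n) = -<- K<n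

  +-∸ : ∀ {a b} → b ℕ.≤ a → + a - + b ≡ + (a ℕ.∸ b)
  +-∸ {a} {b} b≤a = trans ([+m]-[+n]≡m⊖n a b) (⊖-≥ b≤a)

module LinearForms where

  open IntegerBounds
  open import Data.Nat as ℕ using (ℕ; zero; suc; z≤n)
  import Data.Nat.Properties as ℕₚ
  open import Data.Integer using (ℤ; +_; -[1+_]; ∣_∣; _+_; _*_; -_; _-_; 0ℤ; 1ℤ; -1ℤ)
  open import Data.Integer.Properties
    using (∣-i∣≡∣i∣; pos-+; *-identityˡ)
  open import Data.Integer.Tactic.RingSolver using (solve-∀)
  open import Data.Fin using (Fin; zero; suc)
  open import Data.Vec using (Vec; []; _∷_; replicate; zipWith; map)
  open import Data.Vec.Relation.Unary.All as All using (All; []; _∷_)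
  open import Data.List using (List; []; _∷_; [_]; cartesianProductWith)
  open import Data.List.Membership.Propositional using (_∈_)
  open import Data.List.Membership.Propositional.Properties using (∈-cartesianProductWith⁺)
  open import Data.List.Relation.Unary.Any using (here; there)
  open import Data.Sum using (inj₁; inj₂)
  open import Function using (_∘_)
  open import Relation.Unary using (Decidable)
  open import Relation.Binary.PropositionalEquality using (_≡_; refl; sym; cong₂; subst)

  infixl 7 _⊙_ _·_

  _⊙_ : ∀ {n} → Vec ℤ n → (Fin n → ℤ) → ℤ
  [] ⊙ v = 0ℤ
  (x ∷ c) ⊙ v = x * v zero + c ⊙ (v ∘ suc)

  _·_ : ∀ {n} → Vec ℤ n → Env n → ℤ
  c · ρ = c ⊙ (+_ ∘ ρ)

  lincomb : ∀ {n} → ℤ → Vec ℤ n → ℤ → Vec ℤ n → Vec ℤ n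
  lincomb e g f c = zipWith (λ x y → e * x + f * y) g c

  unit : ∀ {n} → Fin n → Vec ℤ n
  unit zero = 1ℤ ∷ replicate _ 0ℤ
  unit (suc i) = 0ℤ ∷ unit i

  ⊙-lincomb : ∀ {n} e g f c (v : Fin n → ℤ) → lincomb e g f c ⊙ v ≡ e * (g ⊙ v) + f * (c ⊙ v)
  ⊙-lincomb e [] f [] v = ring e f
    where
    ring : ∀ e f → 0ℤ ≡ e * 0ℤ + f * 0ℤ
    ring = solve-∀
  ⊙-lincomb e (x ∷ g) f (y ∷ c) v
    rewrite ⊙-lincomb e g f c (v ∘ suc) = ring e x f y (v zero) (g ⊙ (v ∘ suc)) (c ⊙ (v ∘ suc))
    where
    ring : ∀ e x f y w G D → (e * x + f * y) * w + (e * G + f * D) ≡ e * (x * w + G) + f * (y * w + D)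
    ring = solve-∀

  ⊙-neg : ∀ {n} c (v : Fin n → ℤ) → map -_ c ⊙ v ≡ - (c ⊙ v)
  ⊙-neg [] v = refl
  ⊙-neg (x ∷ c) v rewrite ⊙-neg c (v ∘ suc) = ring x (v zero) (c ⊙ (v ∘ suc))
    where
    ring : ∀ x w D → - x * w + - D ≡ - (x * w + D)
    ring = solve-∀

  ⊙-zero : ∀ {n} (v : Fin n → ℤ) → replicate n 0ℤ ⊙ v ≡ 0ℤ
  ⊙-zero {zero} v = refl
  ⊙-zero {suc n} v rewrite ⊙-zero (v ∘ suc) = ring (v zero)
    where
    ring : ∀ w → 0ℤ * w + 0ℤ ≡ 0ℤ
    ring = solve-∀

  ⊙-unit : ∀ {n} (i : Fin n) (v : Fin n → ℤ) → unit i ⊙ v ≡ v i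
  ⊙-unit zero v rewrite ⊙-zero (v ∘ suc) = ring (v zero)
    where
    ring : ∀ w → 1ℤ * w + 0ℤ ≡ w
    ring = solve-∀
  ⊙-unit (suc i) v rewrite ⊙-unit i (v ∘ suc) = ring (v zero) (v (suc i))
    where
    ring : ∀ w u → 0ℤ * w + u ≡ u
    ring = solve-∀

  ⊙-shift : ∀ {n} c (v v' t : Fin n → ℤ) (M : ℤ) →
    (∀ i → v' i ≡ v i + t i * M) → c ⊙ v' ≡ c ⊙ v + (c ⊙ t) * M
  ⊙-shift [] v v' t M eq = ring M
    where
    ring : ∀ M → 0ℤ ≡ 0ℤ + 0ℤ * M
    ring = solve-∀
  ⊙-shift (x ∷ c) v v' t M eq
    rewrite eq zero | ⊙-shift c (v ∘ suc) (v' ∘ suc) (t ∘ suc) M (eq ∘ suc) =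
    ring x (v zero) (t zero) M (c ⊙ (v ∘ suc)) (c ⊙ (t ∘ suc))
    where
    ring : ∀ x w s M D T → x * (w + s * M) + (D + T * M) ≡ x * w + D + (x * s + T) * M
    ring = solve-∀

  Bounded : ∀ {n} → ℕ → Vec ℤ n → Set
  Bounded C = All (λ x → ∣ x ∣ ℕ.≤ C)

  bounded? : ∀ {n} C → Decidable (Bounded {n} C)
  bounded? C = All.all? (λ x → ∣ x ∣ ℕ.≤? C)

  Bounded-mono : ∀ {n C D} {c : Vec ℤ n} → C ℕ.≤ D → Bounded C c → Bounded D c
  Bounded-mono C≤D = All.map (λ x≤C → ℕₚ.≤-trans x≤C C≤D)

  Bounded-neg : ∀ {n C} {c : Vec ℤ n} → Bounded C c → Bounded C (map -_ c)
  Bounded-neg [] = []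
  Bounded-neg {c = x ∷ _} (x≤ ∷ c≤) = subst (ℕ._≤ _) (sym (∣-i∣≡∣i∣ x)) x≤ ∷ Bounded-neg c≤

  Bounded-zero : ∀ {n C} → Bounded C (replicate n 0ℤ)
  Bounded-zero {zero} = []
  Bounded-zero {suc n} = z≤n ∷ Bounded-zero

  Bounded-unit : ∀ {n} (i : Fin n) → Bounded 1 (unit i)
  Bounded-unit zero = ℕₚ.≤-refl ∷ Bounded-zero
  Bounded-unit (suc i) = z≤n ∷ Bounded-unit i

  Bounded-lincomb : ∀ {n E F A B} e f {g c : Vec ℤ n} → ∣ e ∣ ℕ.≤ E → ∣ f ∣ ℕ.≤ F →
    Bounded A g → Bounded B c → Bounded (E ℕ.* A ℕ.+ F ℕ.* B) (lincomb e g f c)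
  Bounded-lincomb e f e≤ f≤ [] [] = []
  Bounded-lincomb e f {x ∷ _} {y ∷ _} e≤ f≤ (x≤ ∷ g≤) (y≤ ∷ c≤) =
    ∣+∣-≤ (e * x) (f * y) (∣*∣-≤ e x e≤ x≤) (∣*∣-≤ f y f≤ y≤) ∷ Bounded-lincomb e f e≤ f≤ g≤ c≤

  ints : ℕ → List ℤ
  ints zero = [ 0ℤ ]
  ints (suc C) = + suc C ∷ -[1+ C ] ∷ ints C

  ∈-ints : ∀ {C} z → ∣ z ∣ ℕ.≤ C → z ∈ ints C
  ∈-ints {zero} (+ zero) _ = here refl
  ∈-ints {suc C} z z≤ with ℕₚ.m≤n⇒m<n∨m≡n z≤
  ∈-ints {suc C} z z≤ | inj₁ z<C = there (there (∈-ints z (ℕₚ.≤-pred z<C)))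
  ∈-ints {suc C} (+ .(suc C)) z≤ | inj₂ refl = here refl
  ∈-ints {suc C} -[1+ .C ] z≤ | inj₂ refl = there (here refl)

  forms : ℕ → ∀ n → List (Vec ℤ n)
  forms C zero = [ [] ]
  forms C (suc n) = cartesianProductWith _∷_ (ints C) (forms C n)

  ∈-forms : ∀ {C n} {c : Vec ℤ n} → Bounded C c → c ∈ forms C n
  ∈-forms [] = here refl
  ∈-forms {c = x ∷ _} (x≤ ∷ c≤) = ∈-cartesianProductWith⁺ _∷_ (∈-ints x x≤) (∈-forms c≤)

  coeff : ∀ {n} → Term n → Vec ℤ n
  coeff (var i) = unit i
  coeff (t ⊕ u) = lincomb 1ℤ (coeff t) 1ℤ (coeff u)

  termSize : ∀ {n} → Term n → ℕ
  termSize (var i) = 1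
  termSize (t ⊕ u) = termSize t ℕ.+ termSize u

  ·-coeff : ∀ {n} (t : Term n) (ρ : Env n) → coeff t · ρ ≡ + evalT ρ t
  ·-coeff (var i) ρ = ⊙-unit i (+_ ∘ ρ)
  ·-coeff (t ⊕ u) ρ
    rewrite ⊙-lincomb 1ℤ (coeff t) 1ℤ (coeff u) (+_ ∘ ρ) | ·-coeff t ρ | ·-coeff u ρ
    | *-identityˡ (+ evalT ρ t) | *-identityˡ (+ evalT ρ u) = sym (pos-+ (evalT ρ t) (evalT ρ u))

  Bounded-coeff : ∀ {n} (t : Term n) → Bounded (termSize t) (coeff t)
  Bounded-coeff (var i) = Bounded-unit i
  Bounded-coeff (t ⊕ u) =
    Bounded-mono (ℕₚ.≤-reflexive (cong₂ ℕ._+_ (ℕₚ.*-identityˡ (termSize t)) (ℕₚ.*-identityˡ (termSize u))))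
      (Bounded-lincomb 1ℤ 1ℤ ℕₚ.≤-refl ℕₚ.≤-refl (Bounded-coeff t) (Bounded-coeff u))

  equation : ∀ {n} → Term n → Term n → Vec ℤ n
  equation t u = lincomb 1ℤ (coeff t) -1ℤ (coeff u)

  ·-equation : ∀ {n} (t u : Term n) (ρ : Env n) → equation t u · ρ ≡ + evalT ρ t - + evalT ρ u
  ·-equation t u ρ rewrite ⊙-lincomb 1ℤ (coeff t) -1ℤ (coeff u) (+_ ∘ ρ) | ·-coeff t ρ | ·-coeff u ρ =
    ring (+ evalT ρ t) (+ evalT ρ u)
    where
    ring : ∀ x y → 1ℤ * x + -1ℤ * y ≡ x - y
    ring = solve-∀

  Bounded-equation : ∀ {n} (t u : Term n) → Bounded (termSize t ℕ.+ termSize u) (equation t u)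
  Bounded-equation t u =
    Bounded-mono (ℕₚ.≤-reflexive (cong₂ ℕ._+_ (ℕₚ.*-identityˡ (termSize t)) (ℕₚ.*-identityˡ (termSize u))))
      (Bounded-lincomb 1ℤ -1ℤ ℕₚ.≤-refl ℕₚ.≤-refl (Bounded-coeff t) (Bounded-coeff u))

module Agreement where

  open IntegerBounds
  open import Data.Nat as ℕ using (ℕ; suc; z≤n)
  import Data.Nat.Properties as ℕₚ
  open import Data.Integer
    using (ℤ; +_; +≤+; ∣_∣; _+_; _*_; -_; _-_; _≤_; _<_; 0ℤ)
  open import Data.Integer.Properties
  open import Data.Integer.Tactic.RingSolver using (solve-∀)
  open import Data.Empty using (⊥-elim)
  open import Relation.Nullary using (yes; no)
  open import Relation.Binary.PropositionalEquality using (_≡_; refl; sym; trans; cong; subst)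

  data Agree (N : ℕ) : ℤ → ℤ → Set where
    equal : ∀ {x} → Agree N x x
    above : ∀ {x y} → + N < x → + N < y → Agree N x y
    below : ∀ {x y} → x < - + N → y < - + N → Agree N x y

  Agree-sym : ∀ {N x y} → Agree N x y → Agree N y x
  Agree-sym equal = equal
  Agree-sym (above x> y>) = above y> x>
  Agree-sym (below x< y<) = below y< x<

  Agree-neg : ∀ {N x y} → Agree N x y → Agree N (- x) (- y)
  Agree-neg equal = equal
  Agree-neg {N} (above x> y>) = below (neg-mono-< x>) (neg-mono-< y>)
  Agree-neg {N} (below x< y<) =
    above (subst (_< _) (neg-involutive (+ N)) (neg-mono-< x<)) (subst (_< _) (neg-involutive (+ N)) (neg-mono-< y<))

  Agree-weaken : ∀ {N N' x y} → N' ℕ.≤ N → Agree N x y → Agree N' x y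
  Agree-weaken N'≤N equal = equal
  Agree-weaken N'≤N (above x> y>) = above (≤-<-trans (+≤+ N'≤N) x>) (≤-<-trans (+≤+ N'≤N) y>)
  Agree-weaken N'≤N (below x< y<) = below (<-≤-trans x< (neg-mono-≤ (+≤+ N'≤N))) (<-≤-trans y< (neg-mono-≤ (+≤+ N'≤N)))

  Agree-nonneg : ∀ {N x y} → Agree N x y → 0ℤ ≤ x → 0ℤ ≤ y
  Agree-nonneg equal 0≤x = 0≤x
  Agree-nonneg (above _ y>) _ = ≤-trans (+≤+ z≤n) (<⇒≤ y>)
  Agree-nonneg (below x< _) 0≤x = ⊥-elim (<-irrefl refl (≤-<-trans 0≤x (<-≤-trans x< neg-≤-pos)))

  Agree-zero : ∀ {N x y} → Agree N x y → x ≡ 0ℤ → y ≡ 0ℤ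
  Agree-zero equal x≡0 = x≡0
  Agree-zero (above x> _) refl = ⊥-elim (<-irrefl refl (≤-<-trans (+≤+ z≤n) x>))
  Agree-zero (below x< _) refl = ⊥-elim (<-irrefl refl (<-≤-trans x< neg-≤-pos))

  perturb-above : ∀ {U K} u v → ∣ u ∣ ℕ.≤ U → + (U ℕ.+ K) < v → + K < u + v
  perturb-above {U} {K} u v u≤ v> = begin-strict
    + K                       ≡⟨ ring (+ U) (+ K) ⟩
    - + U + (+ U + + K)       ≡⟨ cong (λ z → - + U + z) (pos-+ U K) ⟨
    - + U + + (U ℕ.+ K)       <⟨ +-mono-≤-< (≤-trans (neg-mono-≤ (+≤+ u≤)) (-∣i∣≤i u)) v> ⟩
    u + v                     ∎
    where
    open ≤-Reasoning
    ring : ∀ U K → K ≡ - U + (U + K)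
    ring = solve-∀

  perturb-below : ∀ {U K} u v → ∣ u ∣ ℕ.≤ U → v < - + (U ℕ.+ K) → u + v < - + K
  perturb-below {U} {K} u v u≤ v< = subst (_< - + K) (neg-involutive (u + v))
    (neg-mono-< (subst (_ <_) (sym (neg-distrib-+ u v)) (perturb-above (- u) (- v) (subst (ℕ._≤ U) (sym (∣-i∣≡∣i∣ u)) u≤) v>)))
    where
    v> : + (U ℕ.+ K) < - v
    v> = subst (_< - v) (neg-involutive _) (neg-mono-< v<)

  scaled-above : ∀ {e C N U} x u v → e ℕ.≤ C → ∣ u ∣ ℕ.≤ U →
    + (U ℕ.+ C ℕ.* N) < v → + e * x ≡ u + v → + N < x
  scaled-above {e} {C} {N} x u v e≤C u≤ v> ex≡ = *-cancelˡ-<-nonNeg (+ e) (begin-strict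
    + e * + N     ≡⟨ pos-* e N ⟨
    + (e ℕ.* N)   ≤⟨ +≤+ (ℕₚ.*-monoˡ-≤ N e≤C) ⟩
    + (C ℕ.* N)   <⟨ perturb-above u v u≤ v> ⟩
    u + v         ≡⟨ ex≡ ⟨
    + e * x       ∎)
    where open ≤-Reasoning

  scaled-below : ∀ {e C N U} x u v → e ℕ.≤ C → ∣ u ∣ ℕ.≤ U →
    v < - + (U ℕ.+ C ℕ.* N) → + e * x ≡ u + v → x < - + N
  scaled-below {e} x u v e≤C u≤ v< ex≡ =
    subst (_< _) (neg-involutive x) (neg-mono-< (scaled-above (- x) (- u) (- v) e≤C
      (subst (ℕ._≤ _) (sym (∣-i∣≡∣i∣ u)) u≤) (subst (_< - v) (neg-involutive _) (neg-mono-< v<)) e-x≡))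
    where
    e-x≡ : + e * - x ≡ - u + - v
    e-x≡ = trans (sym (neg-distribʳ-* (+ e) x)) (trans (cong -_ ex≡) (neg-distrib-+ u v))

  Agree-cancel : ∀ {e C N U h h' x y} u → 1 ℕ.≤ e → e ℕ.≤ C → ∣ u ∣ ℕ.≤ U →
    Agree (U ℕ.+ C ℕ.* N) h h' → + e * x ≡ u + h → + e * y ≡ u + h' → Agree N x y
  Agree-cancel {suc e} {x = x} {y} u _ _ _ equal ex≡ ey≡ =
    subst (Agree _ x) (*-cancelˡ-≡ (+ suc e) x y (trans ex≡ (sym ey≡))) equal
  Agree-cancel u _ e≤C u≤ (above h> h'>) ex≡ ey≡ =
    above (scaled-above _ u _ e≤C u≤ h> ex≡) (scaled-above _ u _ e≤C u≤ h'> ey≡)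
  Agree-cancel u _ e≤C u≤ (below h< h'<) ex≡ ey≡ =
    below (scaled-below _ u _ e≤C u≤ h< ex≡) (scaled-below _ u _ e≤C u≤ h'< ey≡)

  Agree-shift : ∀ {N D} v d → D ℕ.+ N ℕ.< ∣ v ∣ → ∣ d ∣ ℕ.≤ D → Agree N v (v + d)
  Agree-shift {N} {D} v d big d≤ with 0ℤ ≤? v
  ... | yes 0≤v = above (≤-<-trans (+≤+ (ℕₚ.m≤n+m N D)) v>) (subst (_ <_) (+-comm d v) (perturb-above d v d≤ v>))
    where
    v> : + (D ℕ.+ N) < v
    v> = +K<i 0≤v big
  ... | no v<0 = below (<-≤-trans v< (neg-mono-≤ (+≤+ (ℕₚ.m≤n+m N D)))) (subst (_< _) (+-comm d v) (perturb-below d v d≤ v<))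
    where
    v< : v < - + (D ℕ.+ N)
    v< = i<-K (≰⇒> v<0) big

module Greatest where

  open import Data.List using ([]; _∷_)
  open import Data.List.Membership.Propositional using (_∈_)
  open import Data.List.Relation.Unary.All as All using (All; []; _∷_)
  open import Data.List.Relation.Unary.Any using (here; there)
  open import Data.Product using (∃; _×_; _,_)
  open import Data.Sum using (inj₁; inj₂; reduce)
  open import Relation.Binary.Core using (Rel)
  open import Relation.Binary.Definitions using (Total; Transitive)
  open import Relation.Binary.PropositionalEquality using (refl)

  greatest : ∀ {a ℓ} {A : Set a} {_≼_ : Rel A ℓ} → Total _≼_ → Transitive _≼_ →
    ∀ x xs → ∃ λ b → b ∈ x ∷ xs × All (_≼ b) (x ∷ xs)
  greatest total trans x [] = x , here refl , reduce (total x x) ∷ []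
  greatest total trans x (y ∷ ys) with greatest total trans y ys
  ... | b , b∈ , y∷ys≼b with total x b
  ...   | inj₁ x≼b = b , there b∈ , x≼b ∷ y∷ys≼b
  ...   | inj₂ b≼x = x , here refl , reduce (total x x) ∷ All.map (λ z≼b → trans z≼b b≼x) y∷ys≼b

module Similarity where

  open LinearForms
  open Agreement
  open import Data.Nat as ℕ using (ℕ; suc; _!)
  open import Data.Integer using (ℤ; +_; _+_; _*_; -_)
  open import Data.Integer.Tactic.RingSolver using (solve-∀)
  open import Data.Fin using (Fin)
  open import Relation.Binary.PropositionalEquality using (_≡_)

  record Precision : Set where
    constructor precision
    field
      width threshold modulus : ℕ

  record Sim {n} (p : Precision) (ρ ρ' : Env n) : Set where
    open Precision p
    field
      shift : Fin n → ℤ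
      congruent : ∀ i → + ρ' i ≡ + ρ i + shift i * + modulus
      agree : ∀ c → Bounded width c → Agree threshold (c · ρ) (c · ρ')

  Sim-sym : ∀ {n p} {ρ ρ' : Env n} → Sim p ρ ρ' → Sim p ρ' ρ
  Sim-sym {p = p} {ρ} {ρ'} sim = record
    { shift = λ i → - shift i
    ; congruent = congruent'
    ; agree = λ c c≤ → Agree-sym (agree c c≤)
    }
    where
    open Sim sim
    open Precision p
    congruent' : ∀ i → + ρ i ≡ + ρ' i + - shift i * + modulus
    congruent' i rewrite congruent i = ring (+ ρ i) (shift i) (+ modulus)
      where
      ring : ∀ x t M → x ≡ x + t * M + - t * M
      ring = solve-∀

  cutoff : ℕ → ℕ → ℕ
  cutoff C N = suc (C ℕ.* N)

  slack : ℕ → ℕ → ℕ → ℕ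
  slack C N M = C ℕ.* (cutoff C N ℕ.+ C ℕ.* M)

  -- The precision needed one quantifier deeper: the width covers the forms e·g − f·c obtained by
  -- eliminating the new variable, the modulus is divisible by every pivot coefficient e ≤ C, and the
  -- threshold absorbs f·w for pivot values w of absolute value at most cutoff C N + C·M.
  refine : Precision → Precision
  refine (precision C N M) = precision (C ℕ.* C ℕ.+ C ℕ.* C ℕ.+ C) (slack C N M ℕ.+ C ℕ.* N) (M ℕ.* C !)

module Transfer where

  open IntegerBounds
  open LinearForms
  open Agreement
  open Similarity
  open Greatest
  open import Data.Nat as ℕ using (ℕ; zero; suc; z≤n; s≤s; _⊔_; _!)
  import Data.Nat.Properties as ℕₚ
  open import Data.Nat.DivMod using (_/_; _%_; m≡m%n+[m/n]*n; m%n<n; m%n≤m)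
  open import Data.Nat.Divisibility using (_∣_; divides; ∣-trans; m≤n⇒m!∣n!)
  open import Data.Integer
    using (ℤ; +_; +[1+_]; -[1+_]; +≤+; +<+; ∣_∣; nonNegative; _+_; _*_; -_; _-_; _≤_; _<_; 0ℤ; 1ℤ)
  open import Data.Integer.Properties
  open import Data.Integer.Tactic.RingSolver using (solve-∀)
  open import Data.Fin using (Fin; zero; suc)
  open import Data.Vec using (Vec; _∷_; replicate)
  open import Data.Vec.Relation.Unary.All using (_∷_)
  open import Data.List as List using (List; upTo; cartesianProduct; filter)
  open import Data.List.Membership.Propositional using (_∈_; find; lose)
  open import Data.List.Membership.Propositional.Properties
    using (∈-cartesianProduct⁺; ∈-cartesianProduct⁻; ∈-filter⁺; ∈-filter⁻; ∈-upTo⁺; ∈-upTo⁻)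
  open import Data.List.Relation.Unary.All as All using (All)
  open import Data.List.Relation.Unary.Any using (here; there; any?)
  open import Data.Product using (∃; _×_; _,_; proj₁; proj₂)
  open import Data.Empty using (⊥-elim)
  open import Function using (_∘_)
  open import Relation.Binary.Core using (Rel)
  open import Relation.Binary.Definitions using (Total; Transitive)
  open import Relation.Nullary using (yes; no; _×-dec_)
  open import Relation.Unary using (Decidable)
  open import Relation.Binary.PropositionalEquality
    using (_≡_; refl; sym; trans; cong; subst; subst₂; module ≡-Reasoning)

  module BackAndForth {C N M : ℕ} (C≥1 : 1 ℕ.≤ C) (M≥1 : 1 ℕ.≤ M) {n : ℕ} {ρ ρ' : Env n}
    (sim : Sim (refine (precision C N M)) ρ ρ') (a : ℕ) where

    open Sim sim

    K U : ℕ
    K = cutoff C N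
    U = slack C N M

    val : ℤ → Vec ℤ n → ℤ → Env n → ℤ
    val f g x σ = f * x + g · σ

    Matches : ℤ → Set
    Matches a' = ∀ f g → ∣ f ∣ ℕ.≤ C → Bounded C g → Agree N (val f g (+ a) ρ) (val f g a' ρ')

    eliminate : ∀ e f c g x σ → e * val f g x σ ≡ f * val e c x σ + lincomb e g (- f) c · σ
    eliminate e f c g x σ rewrite ⊙-lincomb e g (- f) c (+_ ∘ σ) = ring e f x (g · σ) (c · σ)
      where
      ring : ∀ e f x G D → e * (f * x + G) ≡ f * (e * x + D) + (e * G + - f * D)
      ring = solve-∀

    eliminated-agree : ∀ e f c g → e ℕ.≤ C → ∣ f ∣ ℕ.≤ C → Bounded C c → Bounded C g →
      Agree (U ℕ.+ C ℕ.* N) (lincomb (+ e) g (- f) c · ρ) (lincomb (+ e) g (- f) c · ρ')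
    eliminated-agree e f c g e≤C f≤C c≤ g≤ = agree _ (Bounded-mono (ℕₚ.m≤m+n _ C)
      (Bounded-lincomb (+ e) (- f) e≤C (subst (ℕ._≤ C) (sym (∣-i∣≡∣i∣ f)) f≤C) g≤ c≤))

    ∣C! : ∀ {e} → 1 ℕ.≤ e → e ℕ.≤ C → e ∣ C !
    ∣C! {suc e} _ e≤C = ∣-trans (divides (e !) (ℕₚ.*-comm (suc e) (e !))) (m≤n⇒m!∣n! e≤C)

    -- Since ρ' − ρ is a multiple of M·C! and e ∣ C!, moving a by multiples of M moves the pivot
    -- value at ρ' to its value at ρ plus any multiple of e·M.
    realign : ∀ e c d → 1 ℕ.≤ e → e ℕ.≤ C →
      ∃ λ t₀ → val (+ e) c (+ a + t₀ * + M) ρ' ≡ val (+ e) c (+ a) ρ + + e * d * + M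
    realign e c d 1≤e e≤C with ∣C! 1≤e e≤C
    ... | divides q C!≡qe = d - T * + q , (begin
      + e * (+ a + (d - T * + q) * + M) + c · ρ'
        ≡⟨ cong (λ z → + e * (+ a + (d - T * + q) * + M) + z) (⊙-shift c (+_ ∘ ρ) (+_ ∘ ρ') shift _ congruent) ⟩
      + e * (+ a + (d - T * + q) * + M) + (c · ρ + T * + (M ℕ.* C !))
        ≡⟨ cong (λ z → + e * (+ a + (d - T * + q) * + M) + (c · ρ + T * z)) M·C!≡ ⟩
      + e * (+ a + (d - T * + q) * + M) + (c · ρ + T * (+ M * (+ q * + e)))
        ≡⟨ ring (+ e) (+ a) d T (+ q) (+ M) (c · ρ) ⟩
      + e * + a + c · ρ + + e * d * + M ∎)
      where
      open ≡-Reasoning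
      T : ℤ
      T = c ⊙ shift
      M·C!≡ : + (M ℕ.* C !) ≡ + M * (+ q * + e)
      M·C!≡ = trans (cong (λ z → + (M ℕ.* z)) C!≡qe) (trans (pos-* M (q ℕ.* e)) (cong (+ M *_) (pos-* q e)))
      ring : ∀ e a d T q M D → e * (a + (d - T * q) * M) + (D + T * (M * (q * e))) ≡ e * a + D + e * d * M
      ring = solve-∀

    N≤threshold : N ℕ.≤ U ℕ.+ C ℕ.* N
    N≤threshold = ℕₚ.≤-trans (ℕₚ.m≤n*m N C ⦃ ℕ.>-nonZero C≥1 ⦄) (ℕₚ.m≤n+m _ U)

    N<K : N ℕ.< K
    N<K = s≤s (ℕₚ.m≤n*m N C ⦃ ℕ.>-nonZero C≥1 ⦄)

    -- A pivot (e , c) stands for the form (1 + e)·x + c, whose head coefficient is positive.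
    pivots : List (ℕ × Vec ℤ n)
    pivots = cartesianProduct (upTo C) (forms C n)

    val-unit : ∀ x σ → val 1ℤ (replicate n 0ℤ) x σ ≡ x
    val-unit x σ rewrite ⊙-zero (+_ ∘ σ) = ring x
      where
      ring : ∀ x → 1ℤ * x + 0ℤ ≡ x
      ring = solve-∀

    exact-case : ∀ e c → 1 ℕ.≤ e → e ℕ.≤ C → Bounded C c → ∣ val (+ e) c (+ a) ρ ∣ ℕ.≤ K →
      ∃ λ t₀ → Matches (+ a + t₀ * + M)
    exact-case e c 1≤e e≤C c≤ w≤K with realign e c 0ℤ 1≤e e≤C
    ... | t₀ , w'≡ = t₀ , λ f g f≤C g≤ →
      Agree-cancel (f * w) 1≤e e≤C (∣*∣-≤ f w f≤C (ℕₚ.≤-trans w≤K (ℕₚ.m≤m+n K _)))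
        (eliminated-agree e f c g e≤C f≤C c≤ g≤)
        (eliminate (+ e) f c g (+ a) ρ)
        (trans (eliminate (+ e) f c g (+ a + t₀ * + M) ρ') (cong (λ z → f * z + _) w'≡w))
      where
      w = val (+ e) c (+ a) ρ
      w'≡w : val (+ e) c (+ a + t₀ * + M) ρ' ≡ w
      w'≡w = trans w'≡ (ring w (+ e) (+ M))
        where
        ring : ∀ w e M → w + e * 0ℤ * M ≡ w
        ring = solve-∀

    Matches⁺ : ℤ → Set
    Matches⁺ a' = ∀ f g → 1 ℕ.≤ f → f ℕ.≤ C → Bounded C g → Agree N (val (+ f) g (+ a) ρ) (val (+ f) g a' ρ')

    matches-from-positive : ∀ {a'} → Matches⁺ a' → Matches a'
    matches-from-positive {a'} m (+ zero) g _ g≤ =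
      subst₂ (Agree N) (sym (zero-head (+ a) ρ)) (sym (zero-head a' ρ'))
        (Agree-weaken N≤threshold (agree g (Bounded-mono (ℕₚ.m≤n+m C _) g≤)))
      where
      zero-head : ∀ x σ → val 0ℤ g x σ ≡ g · σ
      zero-head x σ = trans (cong (_+ g · σ) (*-zeroˡ x)) (+-identityˡ (g · σ))
    matches-from-positive m +[1+ f ] g f≤C g≤ = m (suc f) g (s≤s z≤n) f≤C g≤
    matches-from-positive {a'} m -[1+ f ] g f≤C g≤ =
      subst₂ (Agree N) (neg-head (+ a) ρ) (neg-head a' ρ')
        (Agree-neg (m (suc f) (Data.Vec.map -_ g) (s≤s z≤n) f≤C (Bounded-neg g≤)))
      where
      neg-head : ∀ x σ → - val (+ suc f) (Data.Vec.map -_ g) x σ ≡ val -[1+ f ] g x σ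
      neg-head x σ rewrite ⊙-neg g (+_ ∘ σ) = ring (+ suc f) x (g · σ)
        where
        ring : ∀ f x G → - (f * x + - G) ≡ - f * x + G
        ring = solve-∀

    extension : ∀ t₀ → Matches (+ a + t₀ * + M) →
      ∃ λ a' → Sim (precision C N M) (extend a ρ) (extend a' ρ')
    extension t₀ m = ∣ a' ∣ , record { shift = shift' ; congruent = congruent' ; agree = agree' }
      where
      a' = + a + t₀ * + M
      ∣a'∣≡a' : + ∣ a' ∣ ≡ a'
      ∣a'∣≡a' = 0≤i⇒+∣i∣≡i (Agree-nonneg
        (subst₂ (Agree N) (val-unit (+ a) ρ) (val-unit a' ρ') (m 1ℤ (replicate n 0ℤ) C≥1 Bounded-zero))
        (+≤+ z≤n))
      shift' : Fin (suc n) → ℤ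
      shift' zero = t₀
      shift' (suc i) = shift i * + (C !)
      congruent' : ∀ i → + extend ∣ a' ∣ ρ' i ≡ + extend a ρ i + shift' i * + M
      congruent' zero = ∣a'∣≡a'
      congruent' (suc i) =
        trans (congruent i) (cong (_+_ (+ ρ i)) (trans (cong (shift i *_) (pos-* M (C !))) (ring (shift i) (+ M) (+ (C !)))))
        where
        ring : ∀ t M F → t * (M * F) ≡ t * F * M
        ring = solve-∀
      agree' : ∀ c → Bounded C c → Agree N (c · extend a ρ) (c · extend ∣ a' ∣ ρ')
      agree' (f ∷ g) (f≤ ∷ g≤) = subst (λ z → Agree N (val f g (+ a) ρ) (f * z + g · ρ')) (sym ∣a'∣≡a') (m f g f≤ g≤)

    module FarCase (far : ∀ e c → 1 ℕ.≤ e → e ℕ.≤ C → Bounded C c → K ℕ.< ∣ val (+ e) c (+ a) ρ ∣) where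

      -- (f , g) ≼ (e , c): the lower bound − g·ρ / (1 + f) on x expressed by (f , g) being
      -- nonnegative is at most the one expressed by (e , c).
      _≼_ : Rel (ℕ × Vec ℤ n) _
      (f , g) ≼ (e , c) = + suc f * (c · ρ) ≤ + suc e * (g · ρ)

      ≼-total : Total _≼_
      ≼-total (f , g) (e , c) = ≤-total (+ suc f * (c · ρ)) (+ suc e * (g · ρ))

      ≼-trans : Transitive _≼_
      ≼-trans {f , g} {e , c} {h , d} fg≼ec ec≼hd = *-cancelˡ-≤-pos _ _ (+ suc e) (begin
        + suc e * (+ suc f * (d · ρ))   ≡⟨ swap (+ suc e) (+ suc f) (d · ρ) ⟩
        + suc f * (+ suc e * (d · ρ))   ≤⟨ *-monoˡ-≤-nonNeg (+ suc f) ec≼hd ⟩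
        + suc f * (+ suc h * (c · ρ))   ≡⟨ swap (+ suc f) (+ suc h) (c · ρ) ⟩
        + suc h * (+ suc f * (c · ρ))   ≤⟨ *-monoˡ-≤-nonNeg (+ suc h) fg≼ec ⟩
        + suc h * (+ suc e * (g · ρ))   ≡⟨ swap (+ suc h) (+ suc e) (g · ρ) ⟩
        + suc e * (+ suc h * (g · ρ))   ∎)
        where
        open ≤-Reasoning
        swap : ∀ x y z → x * (y * z) ≡ y * (x * z)
        swap = solve-∀

      Candidate : ℕ × Vec ℤ n → Set
      Candidate (e , c) = Bounded C c × 0ℤ ≤ val (+ suc e) c (+ a) ρ

      candidate? : Decidable Candidate
      candidate? (e , c) = bounded? C c ×-dec (0ℤ ≤? val (+ suc e) c (+ a) ρ)

      seed : ℕ × Vec ℤ n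
      seed = 0 , replicate n 0ℤ

      best : ∃ λ b → proj₁ b ℕ.< C × Candidate b × (∀ f g → f ℕ.< C → Candidate (f , g) → (f , g) ≼ b)
      best with greatest {_≼_ = _≼_} ≼-total (λ {x y z} → ≼-trans {x} {y} {z}) seed (filter candidate? pivots)
      ... | b , b∈ , ≼b = let b<C , b-cand = admissible b∈ in b , b<C , b-cand , λ f g f<C fg-cand →
        All.lookup ≼b (there (∈-filter⁺ candidate? (∈-cartesianProduct⁺ (∈-upTo⁺ f<C) (∈-forms (proj₁ fg-cand))) fg-cand))
        where
        admissible : ∀ {b} → b ∈ seed List.∷ filter candidate? pivots →
          proj₁ b ℕ.< C × Candidate b
        admissible (here refl) = C≥1 , Bounded-zero , subst (0ℤ ≤_) (sym (val-unit (+ a) ρ)) (+≤+ z≤n)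
        admissible (there b∈) with ∈-filter⁻ candidate? b∈
        ... | b∈pivots , b-cand = ∈-upTo⁻ (proj₁ (∈-cartesianProduct⁻ (upTo C) (forms C n) b∈pivots)) , b-cand

      module Pivot (e' : ℕ) (c : Vec ℤ n) (e'<C : e' ℕ.< C) (c-cand : Candidate (e' , c))
        (greatest-c : ∀ f g → f ℕ.< C → Candidate (f , g) → (f , g) ≼ (e' , c)) where

        e : ℕ
        e = suc e'

        w : ℤ
        w = val (+ e) c (+ a) ρ

        w≡W : w ≡ + ∣ w ∣
        w≡W = sym (0≤i⇒+∣i∣≡i (proj₂ c-cand))

        K<W : K ℕ.< ∣ w ∣
        K<W = far e c (s≤s z≤n) e'<C (proj₁ c-cand)

        instance
          eM≢0 : ℕ.NonZero (e ℕ.* M)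
          eM≢0 = ℕ.>-nonZero (ℕₚ.*-mono-≤ (s≤s (z≤n {e'})) M≥1)

        -- a' lowers the value of this tightest pivot from w > K to K + r with r < e·M: it stays
        -- beyond every threshold, and no form that is nonnegative at a can turn negative.
        t₂ r : ℕ
        t₂ = (∣ w ∣ ℕ.∸ K) / (e ℕ.* M)
        r = (∣ w ∣ ℕ.∸ K) % (e ℕ.* M)

        realigned : ∃ λ t₀ → val (+ e) c (+ a + t₀ * + M) ρ' ≡ w + + e * - + t₂ * + M
        realigned = realign e c (- + t₂) (s≤s z≤n) e'<C

        a' : ℤ
        a' = + a + proj₁ realigned * + M

        w' : ℤ
        w' = val (+ e) c a' ρ'

        W≡ : + ∣ w ∣ ≡ + K + (+ r + + t₂ * (+ e * + M))
        W≡ = begin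
          + ∣ w ∣                                  ≡⟨ cong +_ (ℕₚ.m+[n∸m]≡n (ℕₚ.<⇒≤ K<W)) ⟨
          + (K ℕ.+ (∣ w ∣ ℕ.∸ K))                  ≡⟨ cong (λ z → + (K ℕ.+ z)) (m≡m%n+[m/n]*n (∣ w ∣ ℕ.∸ K) (e ℕ.* M)) ⟩
          + (K ℕ.+ (r ℕ.+ t₂ ℕ.* (e ℕ.* M)))       ≡⟨ pos-+ K _ ⟩
          + K + + (r ℕ.+ t₂ ℕ.* (e ℕ.* M))         ≡⟨ cong (_+_ (+ K)) (pos-+ r _) ⟩
          + K + (+ r + + (t₂ ℕ.* (e ℕ.* M)))       ≡⟨ cong (λ z → + K + (+ r + z)) (trans (pos-* t₂ _) (cong (+ t₂ *_) (pos-* e M))) ⟩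
          + K + (+ r + + t₂ * (+ e * + M))         ∎
          where open ≡-Reasoning

        w'≡ : w' ≡ + (K ℕ.+ r)
        w'≡ = begin
          w'                                                     ≡⟨ proj₂ realigned ⟩
          w + + e * - + t₂ * + M                                 ≡⟨ cong (λ z → z + + e * - + t₂ * + M) (trans w≡W W≡) ⟩
          + K + (+ r + + t₂ * (+ e * + M)) + + e * - + t₂ * + M  ≡⟨ ring (+ K) (+ r) (+ t₂) (+ e) (+ M) ⟩
          + K + + r                                              ≡⟨ pos-+ K r ⟨
          + (K ℕ.+ r)                                            ∎
          where
          open ≡-Reasoning
          ring : ∀ K r t e M → K + (r + t * (e * M)) + e * - t * M ≡ K + r
          ring = solve-∀

        w'≤w : w' ≤ w
        w'≤w = subst₂ _≤_ (sym w'≡) (sym w≡W)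
          (+≤+ (subst (K ℕ.+ r ℕ.≤_) (ℕₚ.m+[n∸m]≡n (ℕₚ.<⇒≤ K<W)) (ℕₚ.+-monoʳ-≤ K (m%n≤m _ (e ℕ.* M)))))

        ∣w'∣≤ : ∣ w' ∣ ℕ.≤ K ℕ.+ C ℕ.* M
        ∣w'∣≤ rewrite w'≡ = ℕₚ.+-monoʳ-≤ K (ℕₚ.≤-trans (ℕₚ.<⇒≤ (m%n<n _ (e ℕ.* M))) (ℕₚ.*-monoˡ-≤ M e'<C))

        eliminated-nonneg : ∀ f g → 1 ℕ.≤ f → f ℕ.≤ C → Bounded C g → 0ℤ ≤ val (+ f) g (+ a) ρ →
          0ℤ ≤ lincomb (+ e) g (- + f) c · ρ
        eliminated-nonneg (suc f) g _ f<C g≤ x≥0 rewrite ⊙-lincomb (+ e) g (- + suc f) c (+_ ∘ ρ) =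
          subst (0ℤ ≤_) (ring (+ e) (+ suc f) (g · ρ) (c · ρ)) (i≤j⇒0≤j-i (greatest-c f g f<C (g≤ , x≥0)))
          where
          ring : ∀ e f G D → e * G - f * D ≡ e * G + - f * D
          ring = solve-∀

        above-if-nonneg : ∀ f g → 1 ℕ.≤ f → f ℕ.≤ C → Bounded C g → 0ℤ ≤ val (+ f) g (+ a) ρ →
          + N < val (+ f) g a' ρ'
        above-if-nonneg f g 1≤f f≤C g≤ x≥0 = *-cancelˡ-<-nonNeg (+ e) (begin-strict
          + e * + N                 ≡⟨ pos-* e N ⟨
          + (e ℕ.* N)               ≤⟨ +≤+ (ℕₚ.*-monoˡ-≤ N e'<C) ⟩
          + (C ℕ.* N)               <⟨ +<+ ℕₚ.≤-refl ⟩
          + K                       ≤⟨ +≤+ (ℕₚ.≤-trans (ℕₚ.m≤m+n K r) (ℕₚ.m≤n*m (K ℕ.+ r) f ⦃ ℕ.>-nonZero 1≤f ⦄)) ⟩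
          + (f ℕ.* (K ℕ.+ r))       ≡⟨ trans (cong (+ f *_) w'≡) (sym (pos-* f (K ℕ.+ r))) ⟨
          + f * w'                  ≤⟨ i≤i+j (+ f * w') H' ⦃ nonNegative H'≥0 ⦄ ⟩
          + f * w' + H'             ≡⟨ eliminate (+ e) (+ f) c g a' ρ' ⟨
          + e * val (+ f) g a' ρ'   ∎)
          where
          open ≤-Reasoning
          H' : ℤ
          H' = lincomb (+ e) g (- + f) c · ρ'
          H'≥0 : 0ℤ ≤ H'
          H'≥0 = Agree-nonneg (eliminated-agree e (+ f) c g e'<C f≤C (proj₁ c-cand) g≤) (eliminated-nonneg f g 1≤f f≤C g≤ x≥0)

        below-if-neg : ∀ f g → 1 ℕ.≤ f → f ℕ.≤ C → Bounded C g → val (+ f) g (+ a) ρ < - + N →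
          val (+ f) g a' ρ' < - + N
        below-if-neg f g 1≤f f≤C g≤ x<-N =
          y<-N (eliminated-agree e (+ f) c g e'<C f≤C (proj₁ c-cand) g≤) (eliminate (+ e) (+ f) c g a' ρ')
          where
          x y H : ℤ
          x = val (+ f) g (+ a) ρ
          y = val (+ f) g a' ρ'
          H = lincomb (+ e) g (- + f) c · ρ
          fw≥0 : 0ℤ ≤ + f * w
          fw≥0 = subst (0ℤ ≤_) (cong (+ f *_) (sym w≡W)) (subst (0ℤ ≤_) (pos-* f _) (+≤+ z≤n))
          H<0 : H < 0ℤ
          H<0 = ≤-<-trans (i≤j+i H (+ f * w) ⦃ nonNegative fw≥0 ⦄) (subst (_< 0ℤ) (eliminate (+ e) (+ f) c g (+ a) ρ)
            (subst (+ e * x <_) (*-zeroʳ (+ e)) (*-monoˡ-<-pos (+ e) (<-≤-trans x<-N neg-≤-pos))))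
          y<-N : ∀ {h'} → Agree (U ℕ.+ C ℕ.* N) H h' → + e * y ≡ + f * w' + h' → y < - + N
          y<-N equal ey≡ = ≤-<-trans (*-cancelˡ-≤-pos y x (+ e) (begin
            + e * y        ≡⟨ ey≡ ⟩
            + f * w' + H   ≤⟨ +-monoˡ-≤ H (*-monoˡ-≤-nonNeg (+ f) w'≤w) ⟩
            + f * w + H    ≡⟨ eliminate (+ e) (+ f) c g (+ a) ρ ⟨
            + e * x        ∎)) x<-N
            where open ≤-Reasoning
          y<-N (above H> _) _ = ⊥-elim (<-asym H<0 (≤-<-trans (+≤+ z≤n) H>))
          y<-N (below _ h'<) ey≡ = scaled-below y (+ f * w') _ e'<C (∣*∣-≤ (+ f) w' f≤C ∣w'∣≤) h'< ey≡

        matches⁺ : Matches⁺ a'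
        matches⁺ f g 1≤f f≤C g≤ with 0ℤ ≤? val (+ f) g (+ a) ρ
        ... | yes x≥0 = above (<-trans (+<+ N<K) (+K<i x≥0 (far f g 1≤f f≤C g≤))) (above-if-nonneg f g 1≤f f≤C g≤ x≥0)
        ... | no x≱0 = below x<-N (below-if-neg f g 1≤f f≤C g≤ x<-N)
          where
          x<-N : val (+ f) g (+ a) ρ < - + N
          x<-N = <-≤-trans (i<-K (≰⇒> x≱0) (far f g 1≤f f≤C g≤)) (neg-mono-≤ (+≤+ (ℕₚ.<⇒≤ N<K)))

        result : ∃ λ t₀ → Matches (+ a + t₀ * + M)
        result = proj₁ realigned , matches-from-positive matches⁺

      far-case : ∃ λ t₀ → Matches (+ a + t₀ * + M)
      far-case with best
      ... | (e' , c) , e'<C , c-cand , greatest-c = Pivot.result e' c e'<C c-cand greatest-c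

    Close : ℕ × Vec ℤ n → Set
    Close (e , c) = Bounded C c × ∣ val (+ suc e) c (+ a) ρ ∣ ℕ.≤ K

    close? : Decidable Close
    close? (e , c) = bounded? C c ×-dec (∣ val (+ suc e) c (+ a) ρ ∣ ℕ.≤? K)

    answer : ∃ λ a' → Sim (precision C N M) (extend a ρ) (extend a' ρ')
    answer with any? close? pivots
    ... | yes some-close =
      let (e , c) , ec∈ , c≤ , w≤K = find some-close
          t₀ , matches = exact-case (suc e) c (s≤s z≤n) (∈-upTo⁻ (proj₁ (∈-cartesianProduct⁻ (upTo C) (forms C n) ec∈))) c≤ w≤K
      in extension t₀ matches
    ... | no none-close = extension (proj₁ FC.far-case) (proj₂ FC.far-case)
      where
      far : ∀ e c → 1 ℕ.≤ e → e ℕ.≤ C → Bounded C c → K ℕ.< ∣ val (+ e) c (+ a) ρ ∣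
      far (suc e) c _ e<C c≤ = ℕₚ.≰⇒> λ w≤K →
        none-close (lose (∈-cartesianProduct⁺ (∈-upTo⁺ e<C) (∈-forms c≤)) (c≤ , w≤K))
      module FC = FarCase far

  level : ℕ → ℕ → Precision
  level B zero = precision (suc B) 0 1
  level B (suc k) = refine (level B k)

  width-≥ : ∀ B k → suc B ℕ.≤ Precision.width (level B k)
  width-≥ B zero = ℕₚ.≤-refl
  width-≥ B (suc k) = ℕₚ.≤-trans (width-≥ B k) (ℕₚ.m≤n+m _ _)

  modulus-≥1 : ∀ B k → 1 ℕ.≤ Precision.modulus (level B k)
  modulus-≥1 B zero = ℕₚ.≤-refl
  modulus-≥1 B (suc k) = ℕₚ.*-mono-≤ (modulus-≥1 B k) (ℕₚ.1≤n! (Precision.width (level B k)))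

  back-and-forth : ∀ {n B k} {ρ ρ' : Env n} → Sim (level B (suc k)) ρ ρ' →
    ∀ a → ∃ λ a' → Sim (level B k) (extend a ρ) (extend a' ρ')
  back-and-forth {B = B} {k} = BackAndForth.answer (ℕₚ.≤-trans (s≤s z≤n) (width-≥ B k)) (modulus-≥1 B k)

  size : ∀ {n} → Formula n → ℕ
  size (t ≐ u) = termSize t ℕ.+ termSize u
  size ⊥' = 0
  size (φ ⇒ ψ) = size φ ⊔ size ψ
  size (all φ) = size φ

  rank : ∀ {n} → Formula n → ℕ
  rank (t ≐ u) = 0
  rank ⊥' = 0
  rank (φ ⇒ ψ) = rank φ ⊔ rank ψ
  rank (all φ) = suc (rank φ)

  transfer : ∀ {n B k} (φ : Formula n) → size φ ℕ.≤ B → rank φ ℕ.≤ k →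
    ∀ {ρ ρ'} → Sim (level B k) ρ ρ' → ⟦ φ ⟧ ρ → ⟦ φ ⟧ ρ'
  transfer {B = B} {k} (t ≐ u) size≤ _ {ρ} {ρ'} sim t≡u =
    +-injective (i-j≡0⇒i≡j _ _ (trans (sym (·-equation t u ρ')) (Agree-zero (agree _ bounded) eq₀)))
    where
    open Sim sim
    bounded : Bounded (Precision.width (level B k)) (equation t u)
    bounded = Bounded-mono (ℕₚ.≤-trans size≤ (ℕₚ.≤-trans (ℕₚ.n≤1+n B) (width-≥ B k))) (Bounded-equation t u)
    eq₀ : equation t u · ρ ≡ 0ℤ
    eq₀ = trans (·-equation t u ρ) (i≡j⇒i-j≡0 (cong +_ t≡u))
  transfer ⊥' _ _ _ ()
  transfer (φ ⇒ ψ) size≤ rank≤ sim φ→ψ φ' =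
    transfer ψ (ℕₚ.m⊔n≤o⇒n≤o _ _ size≤) (ℕₚ.m⊔n≤o⇒n≤o _ _ rank≤) sim
      (φ→ψ (transfer φ (ℕₚ.m⊔n≤o⇒m≤o _ _ size≤) (ℕₚ.m⊔n≤o⇒m≤o _ _ rank≤) (Sim-sym sim) φ'))
  transfer {k = suc k} (all φ) size≤ (s≤s rank≤) sim ∀φ a' =
    let a , sim' = back-and-forth (Sim-sym sim) a' in transfer φ size≤ rank≤ (Sim-sym sim') (∀φ a)

module Renaming where

  open import Data.Nat using (ℕ; _+_)
  open import Data.Fin using (Fin; zero; suc; lift)
  open import Data.Product using (_,_)
  open import Function.Bundles using (_⇔_; mk⇔; Equivalence)
  import Function.Properties.Equivalence as ⇔
  open import Relation.Binary.PropositionalEquality using (_≡_; refl; sym; trans; cong₂)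

  renameT : ∀ {m n} → (Fin m → Fin n) → Term m → Term n
  renameT π (var i) = var (π i)
  renameT π (t ⊕ u) = renameT π t ⊕ renameT π u

  rename : ∀ {m n} → (Fin m → Fin n) → Formula m → Formula n
  rename π (t ≐ u) = renameT π t ≐ renameT π u
  rename π ⊥' = ⊥'
  rename π (φ ⇒ ψ) = rename π φ ⇒ rename π ψ
  rename π (all φ) = all (rename (lift 1 π) φ)

  evalT-rename : ∀ {m n} (π : Fin m → Fin n) t {ρ σ} → (∀ i → ρ (π i) ≡ σ i) → evalT ρ (renameT π t) ≡ evalT σ t
  evalT-rename π (var i) ρπ≡σ = ρπ≡σ i
  evalT-rename π (t ⊕ u) ρπ≡σ = cong₂ _+_ (evalT-rename π t ρπ≡σ) (evalT-rename π u ρπ≡σ)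

  ⟦rename⟧ : ∀ {m n} (π : Fin m → Fin n) φ {ρ σ} → (∀ i → ρ (π i) ≡ σ i) → ⟦ rename π φ ⟧ ρ ⇔ ⟦ φ ⟧ σ
  ⟦rename⟧ π (t ≐ u) ρπ≡σ = mk⇔
    (λ eq → trans (sym (evalT-rename π t ρπ≡σ)) (trans eq (evalT-rename π u ρπ≡σ)))
    (λ eq → trans (evalT-rename π t ρπ≡σ) (trans eq (sym (evalT-rename π u ρπ≡σ))))
  ⟦rename⟧ π ⊥' ρπ≡σ = ⇔.refl
  ⟦rename⟧ π (φ ⇒ ψ) {ρ} {σ} ρπ≡σ = mk⇔
    (λ h x → Equivalence.to ψ⇔ (h (Equivalence.from φ⇔ x)))
    (λ h x → Equivalence.from ψ⇔ (h (Equivalence.to φ⇔ x)))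
    where
    φ⇔ : ⟦ rename π φ ⟧ ρ ⇔ ⟦ φ ⟧ σ
    φ⇔ = ⟦rename⟧ π φ ρπ≡σ
    ψ⇔ : ⟦ rename π ψ ⟧ ρ ⇔ ⟦ ψ ⟧ σ
    ψ⇔ = ⟦rename⟧ π ψ ρπ≡σ
  ⟦rename⟧ π (all φ) {ρ} {σ} ρπ≡σ = mk⇔
    (λ h a → Equivalence.to (φ⇔ a) (h a))
    (λ h a → Equivalence.from (φ⇔ a) (h a))
    where
    lifted : ∀ a i → extend a ρ (lift 1 π i) ≡ extend a σ i
    lifted a zero = refl
    lifted a (suc i) = ρπ≡σ i
    φ⇔ : ∀ a → ⟦ rename (lift 1 π) φ ⟧ (extend a ρ) ⇔ ⟦ φ ⟧ (extend a σ)
    φ⇔ a = ⟦rename⟧ (lift 1 π) φ (lifted a)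

  swap-pairs : Fin 4 → Fin 4
  swap-pairs zero = suc zero
  swap-pairs (suc zero) = zero
  swap-pairs (suc (suc zero)) = suc (suc (suc zero))
  swap-pairs (suc (suc (suc zero))) = suc (suc zero)

  Definable4-swap : ∀ {R : ℕ → ℕ → ℕ → ℕ → Set} → Definable4 R → Definable4 (λ a₁ a₂ b₁ b₂ → R a₂ a₁ b₂ b₁)
  Definable4-swap (φ , R⇔φ) = rename swap-pairs φ , λ a₁ a₂ b₁ b₂ →
    ⇔.trans (R⇔φ a₂ a₁ b₂ b₁) (⇔.sym (⟦rename⟧ swap-pairs φ (swapped a₁ a₂ b₁ b₂)))
    where
    swapped : ∀ a₁ a₂ b₁ b₂ i → env4 a₁ a₂ b₁ b₂ (swap-pairs i) ≡ env4 a₂ a₁ b₂ b₁ i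
    swapped a₁ a₂ b₁ b₂ zero = refl
    swapped a₁ a₂ b₁ b₂ (suc zero) = refl
    swapped a₁ a₂ b₁ b₂ (suc (suc zero)) = refl
    swapped a₁ a₂ b₁ b₂ (suc (suc (suc zero))) = refl

module NonSquare where

  open import Data.Nat
  open import Data.Nat.Properties
  open import Data.Nat.DivMod using (_/_; m/n*n≡m)
  open import Data.Nat.Divisibility using (_∣_; divides; ∣-refl; ∣1⇒≡1)
  open import Data.Nat.GCD using (gcd; gcd[m,n]∣m; gcd[m,n]∣n; gcd[m,n]≢0)
  open import Data.Nat.Coprimality using (Coprime; coprime-/gcd; coprime-divisor)
  import Data.Nat.Coprimality as Coprime
  open import Data.Nat.Tactic.RingSolver using (solve-∀)
  open import Data.Product using (_,_)
  open import Data.Sum using (inj₂)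
  open import Relation.Binary.PropositionalEquality

  square-ratio : ∀ s x y → .{{NonZero y}} → x * x ≡ s * (y * y) → IsSquare s
  square-ratio s x y x²≡sy² = x′ , (begin
    x′ * x′         ≡⟨ reduced ⟩
    s * (y′ * y′)   ≡⟨ cong (λ z → s * (z * z)) y′≡1 ⟩
    s * 1           ≡⟨ *-identityʳ s ⟩
    s               ∎)
    where
    open ≡-Reasoning
    g : ℕ
    g = gcd x y
    instance
      g≢0 : NonZero g
      g≢0 = ≢-nonZero (gcd[m,n]≢0 x y (inj₂ (≢-nonZero⁻¹ y)))
    x′ y′ : ℕ
    x′ = x / g
    y′ = y / g
    x≡ : x′ * g ≡ x
    x≡ = m/n*n≡m (gcd[m,n]∣m x y)
    y≡ : y′ * g ≡ y
    y≡ = m/n*n≡m (gcd[m,n]∣n x y)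
    reduced : x′ * x′ ≡ s * (y′ * y′)
    reduced = *-cancelʳ-≡ _ _ (g * g) ⦃ m*n≢0 g g ⦄ (begin
      x′ * x′ * (g * g)        ≡⟨ ring x′ g ⟩
      (x′ * g) * (x′ * g)      ≡⟨ cong₂ _*_ x≡ x≡ ⟩
      x * x                    ≡⟨ x²≡sy² ⟩
      s * (y * y)              ≡⟨ cong₂ (λ u v → s * (u * v)) y≡ y≡ ⟨
      s * ((y′ * g) * (y′ * g)) ≡⟨ ring′ s y′ g ⟩
      s * (y′ * y′) * (g * g)  ∎)
      where
      ring : ∀ a g → a * a * (g * g) ≡ (a * g) * (a * g)
      ring = solve-∀
      ring′ : ∀ s b g → s * ((b * g) * (b * g)) ≡ s * (b * b) * (g * g)
      ring′ = solve-∀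
    coprime : Coprime x′ y′
    coprime = coprime-/gcd x y
    y′∣x′ : y′ ∣ x′
    y′∣x′ = coprime-divisor (Coprime.sym coprime) (divides (s * y′) (trans reduced (sym (*-assoc s y′ y′))))
    y′≡1 : y′ ≡ 1
    y′≡1 = coprime (y′∣x′ , ∣-refl)

module Triangular where

  open import Data.Nat
  open import Data.Nat.Properties
  open import Data.Nat.DivMod using (_/_; m*n/n≡m)
  open import Data.Nat.Tactic.RingSolver using (solve-∀)
  open import Data.Product using (_×_; _,_; proj₁; proj₂)
  open import Data.Empty using (⊥-elim)
  open import Relation.Nullary using (yes; no)
  open import Relation.Binary.PropositionalEquality

  tri : ℕ → ℕ
  tri zero = 0
  tri (suc n) = suc n + tri n

  2*tri : ∀ n → 2 * tri n ≡ n * n + n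
  2*tri zero = refl
  2*tri (suc n) rewrite *-distribˡ-+ 2 (suc n) (tri n) | 2*tri n = ring n
    where
    ring : ∀ n → 2 * (1 + n) + (n * n + n) ≡ (1 + n) * (1 + n) + (1 + n)
    ring = solve-∀

  C₁≡tri : ∀ x y → C₁ x y ≡ tri (x + y) + y
  C₁≡tri x y = trans (cong (_/ 2) twice) (m*n/n≡m (tri (x + y) + y) 2)
    where
    twice : (x + y) * (x + y) + x + 3 * y ≡ (tri (x + y) + y) * 2
    twice = begin
      (x + y) * (x + y) + x + 3 * y           ≡⟨ ring x y ⟩
      ((x + y) * (x + y) + (x + y)) + 2 * y   ≡⟨ cong (_+ 2 * y) (2*tri (x + y)) ⟨
      2 * tri (x + y) + 2 * y                 ≡⟨ ring′ (tri (x + y)) y ⟩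
      (tri (x + y) + y) * 2                   ∎
      where
      open ≡-Reasoning
      ring : ∀ x y → (x + y) * (x + y) + x + 3 * y ≡ ((x + y) * (x + y) + (x + y)) + 2 * y
      ring = solve-∀
      ring′ : ∀ t y → 2 * t + 2 * y ≡ (t + y) * 2
      ring′ = solve-∀

  tri-mono-≤ : ∀ {a b} → a ≤ b → tri a ≤ tri b
  tri-mono-≤ {zero} _ = z≤n
  tri-mono-≤ {suc a} {suc b} (s≤s a≤b) = +-mono-≤ (s≤s a≤b) (tri-mono-≤ a≤b)

  tri-+ : ∀ a b → tri (a + b) ≡ tri a + a * b + tri b
  tri-+ a b = *-cancelˡ-≡ (tri (a + b)) (tri a + a * b + tri b) 2 (begin
    2 * tri (a + b)                          ≡⟨ 2*tri (a + b) ⟩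
    (a + b) * (a + b) + (a + b)              ≡⟨ ring a b ⟩
    (a * a + a) + 2 * (a * b) + (b * b + b)  ≡⟨ cong₂ (λ u v → u + 2 * (a * b) + v) (2*tri a) (2*tri b) ⟨
    2 * tri a + 2 * (a * b) + 2 * tri b      ≡⟨ ring′ (tri a) (a * b) (tri b) ⟩
    2 * (tri a + a * b + tri b)              ∎)
    where
    open ≡-Reasoning
    ring : ∀ a b → (a + b) * (a + b) + (a + b) ≡ (a * a + a) + 2 * (a * b) + (b * b + b)
    ring = solve-∀
    ring′ : ∀ x y z → 2 * x + 2 * y + 2 * z ≡ 2 * (x + y + z)
    ring′ = solve-∀

  troot : ℕ → ℕ
  troot zero = 0
  troot (suc v) with tri (suc (troot v)) ≤? suc v
  ... | yes _ = suc (troot v)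
  ... | no _ = troot v

  troot-spec : ∀ v → tri (troot v) ≤ v × v < tri (suc (troot v))
  troot-spec zero = z≤n , s≤s z≤n
  troot-spec (suc v) with tri (suc (troot v)) ≤? suc v | troot-spec v
  ... | yes fits | _ , v< = fits , s≤s (≤-trans v< (m≤n+m (tri (suc (troot v))) (suc (troot v))))
  ... | no misses | fits , _ = m≤n⇒m≤1+n fits , ≰⇒> misses

  troot-max : ∀ v j → tri j ≤ v → j ≤ troot v
  troot-max v j tri-j≤v with j ≤? troot v
  ... | yes j≤ = j≤
  ... | no j≰ = ⊥-elim (<⇒≱ (proj₂ (troot-spec v)) (≤-trans (tri-mono-≤ (≰⇒> j≰)) tri-j≤v))

  troot-mono-≤ : ∀ {u v} → u ≤ v → troot u ≤ troot v
  troot-mono-≤ {u} {v} u≤v = troot-max v (troot u) (≤-trans (proj₁ (troot-spec u)) u≤v)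

  odd-square : ∀ n → (2 * n + 1) * (2 * n + 1) ≡ 8 * tri n + 1
  odd-square n = begin
    (2 * n + 1) * (2 * n + 1)  ≡⟨ ring n ⟩
    4 * (n * n + n) + 1        ≡⟨ cong (λ z → 4 * z + 1) (2*tri n) ⟨
    4 * (2 * tri n) + 1        ≡⟨ cong (_+ 1) (*-assoc 4 2 (tri n)) ⟨
    8 * tri n + 1              ∎
    where
    open ≡-Reasoning
    ring : ∀ n → (2 * n + 1) * (2 * n + 1) ≡ 4 * (n * n + n) + 1
    ring = solve-∀

  module Orbit (s : ℕ) (1≤s : 1 ≤ s) where

    -- Since C₁ x y = tri (x + y) + y, the point f (n , 0) is (diag n ∸ offset n , offset n).
    diag offset : ℕ → ℕ
    diag n = troot (s * tri n)
    offset n = s * tri n ∸ tri (diag n)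

    tri-diag+offset : ∀ n → tri (diag n) + offset n ≡ s * tri n
    tri-diag+offset n = m+[n∸m]≡n (proj₁ (troot-spec (s * tri n)))

    offset≤diag : ∀ n → offset n ≤ diag n
    offset≤diag n = ≤-pred (+-cancelˡ-< (tri (diag n)) (offset n) (suc (diag n)) (begin-strict
      tri (diag n) + offset n      ≡⟨ tri-diag+offset n ⟩
      s * tri n                    <⟨ proj₂ (troot-spec (s * tri n)) ⟩
      tri (suc (diag n))           ≡⟨ +-comm (suc (diag n)) (tri (diag n)) ⟩
      tri (diag n) + suc (diag n)  ∎))
      where open ≤-Reasoning

    n≤diag : ∀ n → n ≤ diag n
    n≤diag n = troot-max (s * tri n) n (subst (_≤ s * tri n) (*-identityˡ (tri n)) (*-monoˡ-≤ (tri n) 1≤s))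

    diag≤s*n : ∀ n → diag n ≤ s * n
    diag≤s*n n with diag n ≤? s * n
    ... | yes ≤sn = ≤sn
    ... | no ≰sn = ⊥-elim (<⇒≱ (s≤s (m≤n+m (tri (s * n)) (s * n)))
      (≤-trans (tri-mono-≤ (≰⇒> ≰sn)) (≤-trans (proj₁ (troot-spec (s * tri n))) s·tri≤tri-s·)))
      where
      s·tri≤tri-s· : s * tri n ≤ tri (s * n)
      s·tri≤tri-s· = *-cancelˡ-≤ 2 (begin
        2 * (s * tri n)          ≡⟨ ring s (tri n) ⟩
        s * (2 * tri n)          ≡⟨ cong (s *_) (2*tri n) ⟩
        s * (n * n + n)          ≡⟨ ring′ s n ⟩
        s * n * n + s * n        ≤⟨ +-monoˡ-≤ (s * n) (*-monoʳ-≤ (s * n) (subst (_≤ s * n) (*-identityˡ n) (*-monoˡ-≤ n 1≤s))) ⟩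
        s * n * (s * n) + s * n  ≡⟨ 2*tri (s * n) ⟨
        2 * tri (s * n)          ∎)
        where
        open ≤-Reasoning
        ring : ∀ s t → 2 * (s * t) ≡ s * (2 * t)
        ring = solve-∀
        ring′ : ∀ s n → s * (n * n + n) ≡ s * n * n + s * n
        ring′ = solve-∀

    diag-mono-≤ : ∀ {n₁ n₂} → n₁ ≤ n₂ → diag n₁ ≤ diag n₂
    diag-mono-≤ n₁≤n₂ = troot-mono-≤ (*-monoʳ-≤ s (tri-mono-≤ n₁≤n₂))

    gap : ℕ → ℕ
    gap W = s * W + s * tri W

    diag-gap : ∀ W {n₁ n₂} → n₁ ≤ n₂ → n₂ ≤ n₁ + W → diag n₂ ≤ diag n₁ + gap W
    diag-gap W {n₁} {n₂} n₁≤n₂ n₂≤ with diag n₂ ≤? diag n₁ + gap W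
    ... | yes ≤gap = ≤gap
    ... | no ≰gap = ⊥-elim (<-irrefl refl (<-≤-trans below above))
      where
      m₁ : ℕ
      m₁ = diag n₁
      above : tri (suc m₁ + gap W) ≤ s * tri n₁ + (s * (n₁ * W) + s * tri W)
      above = begin
        tri (suc m₁ + gap W)            ≤⟨ tri-mono-≤ (≰⇒> ≰gap) ⟩
        tri (diag n₂)                   ≤⟨ proj₁ (troot-spec (s * tri n₂)) ⟩
        s * tri n₂                      ≤⟨ *-monoʳ-≤ s (tri-mono-≤ n₂≤) ⟩
        s * tri (n₁ + W)                ≡⟨ cong (s *_) (tri-+ n₁ W) ⟩
        s * (tri n₁ + n₁ * W + tri W)   ≡⟨ ring s (tri n₁) (n₁ * W) (tri W) ⟩
        s * tri n₁ + (s * (n₁ * W) + s * tri W) ∎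
        where
        open ≤-Reasoning
        ring : ∀ s a b c → s * (a + b + c) ≡ s * a + (s * b + s * c)
        ring = solve-∀
      below : s * tri n₁ + (s * (n₁ * W) + s * tri W) < tri (suc m₁ + gap W)
      below = begin-strict
        s * tri n₁ + (s * (n₁ * W) + s * tri W) ≤⟨ +-monoʳ-≤ (s * tri n₁) (spread s n₁ W (tri W)) ⟩
        s * tri n₁ + suc n₁ * gap W             <⟨ +-monoˡ-< (suc n₁ * gap W) (proj₂ (troot-spec (s * tri n₁))) ⟩
        tri (suc m₁) + suc n₁ * gap W           ≤⟨ +-monoʳ-≤ (tri (suc m₁)) (*-monoˡ-≤ (gap W) (s≤s (n≤diag n₁))) ⟩
        tri (suc m₁) + suc m₁ * gap W           ≤⟨ m≤m+n _ (tri (gap W)) ⟩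
        tri (suc m₁) + suc m₁ * gap W + tri (gap W) ≡⟨ tri-+ (suc m₁) (gap W) ⟨
        tri (suc m₁ + gap W)                    ∎
        where
        open ≤-Reasoning
        spread : ∀ s n W T → s * (n * W) + s * T ≤ suc n * (s * W + s * T)
        spread s n W T = subst (s * (n * W) + s * T ≤_) (ring s n W T) (m≤m+n (s * (n * W) + s * T) (s * W + n * (s * T)))
          where
          ring : ∀ s n W T → s * (n * W) + s * T + (s * W + n * (s * T)) ≡ suc n * (s * W + s * T)
          ring = solve-∀

module Conic where

  open IntegerBounds
  open import Data.Nat as ℕ using (ℕ; z≤n; s≤s)
  import Data.Nat.Properties as ℕₚ
  import Data.Nat.Tactic.RingSolver as ℕ-Ring
  open import Data.Integer using (ℤ; +_; ∣_∣; _+_; _*_; -_; _-_; 0ℤ)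
  open import Data.Integer.Properties using (∣i*j∣≡∣i∣*∣j∣; ∣i∣≡0⇒i≡0; _≟_)
  open import Data.Integer.Tactic.RingSolver using (solve-∀)
  open import Data.Product using (_×_; _,_; proj₁; proj₂)
  open import Relation.Nullary using (yes; no)
  open import Data.Empty using (⊥-elim)
  open import Function using (_∘_)
  open import Relation.Binary.PropositionalEquality using (_≡_; sym; cong; cong₂; subst; module ≡-Reasoning)

  Coeffs : Set
  Coeffs = ℤ × ℤ × ℤ

  Admissible : ℕ → Coeffs → Set
  Admissible C (α , β , k) = ∣ α ∣ ℕ.≤ C × ∣ β ∣ ℕ.≤ C × 1 ℕ.≤ ∣ k ∣ × ∣ k ∣ ℕ.≤ C ℕ.+ C

  module Rigidity {s : ℕ} (1≤s : 1 ℕ.≤ s) (C E : ℕ) where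

    Q : ℤ → ℤ → ℤ
    Q X Y = X * X - + s * (Y * Y)

    record Near (α β k X Y : ℤ) : Set where
      field
        ε : ℤ
        ε≤ : ∣ ε ∣ ℕ.≤ E
        equation : k * Q X Y ≡ + 4 * α * Y + + 4 * β * X + ε

    cross-bound : ℕ → ℕ
    cross-bound D = 4 ℕ.* C ℕ.* D ℕ.+ 4 ℕ.* C ℕ.* D ℕ.+ (E ℕ.+ E) ℕ.+ (C ℕ.+ C) ℕ.* (D ℕ.* D ℕ.+ s ℕ.* (D ℕ.* D))

    height-bound : ℕ → ℕ
    height-bound D = cross-bound D ℕ.* (D ℕ.+ D) ℕ.+ 8 ℕ.* (D ℕ.* D)

    module _ {α β k : ℤ} (adm : Admissible C (α , β , k)) (D : ℕ) {X₁ Y₁ X₂ Y₂ : ℤ}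
      (near₁ : Near α β k X₁ Y₁) (near₂ : Near α β k X₂ Y₂)
      (ΔX≤ : ∣ X₂ - X₁ ∣ ℕ.≤ D) (ΔY≤ : ∣ Y₂ - Y₁ ∣ ℕ.≤ D) where

      α≤ : ∣ α ∣ ℕ.≤ C
      α≤ = proj₁ adm
      β≤ : ∣ β ∣ ℕ.≤ C
      β≤ = proj₁ (proj₂ adm)
      1≤k : 1 ℕ.≤ ∣ k ∣
      1≤k = proj₁ (proj₂ (proj₂ adm))
      k≤ : ∣ k ∣ ℕ.≤ C ℕ.+ C
      k≤ = proj₂ (proj₂ (proj₂ adm))

      open Near near₁ renaming (ε to ε₁; ε≤ to ε₁≤; equation to eq₁)
      open Near near₂ renaming (ε to ε₂; ε≤ to ε₂≤; equation to eq₂)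

      ΔX ΔY cross : ℤ
      ΔX = X₂ - X₁
      ΔY = Y₂ - Y₁
      cross = X₁ * ΔX - + s * Y₁ * ΔY

      ∣cross∣≤ : ∣ cross ∣ ℕ.≤ cross-bound D
      ∣cross∣≤ = ℕₚ.≤-trans ∣cross∣≤∣2kcross∣ (subst (λ z → ∣ z ∣ ℕ.≤ cross-bound D) (sym 2kcross≡)
        (∣-∣-≤ (+ 4 * α * ΔY + + 4 * β * ΔX + (ε₂ - ε₁)) (k * Q ΔX ΔY)
          (∣+∣-≤ (+ 4 * α * ΔY + + 4 * β * ΔX) (ε₂ - ε₁)
            (∣+∣-≤ (+ 4 * α * ΔY) (+ 4 * β * ΔX)
              (∣*∣-≤ (+ 4 * α) ΔY (∣*∣-≤ (+ 4) α ℕₚ.≤-refl α≤) ΔY≤)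
              (∣*∣-≤ (+ 4 * β) ΔX (∣*∣-≤ (+ 4) β ℕₚ.≤-refl β≤) ΔX≤))
            (∣-∣-≤ ε₂ ε₁ ε₂≤ ε₁≤))
          (∣*∣-≤ k (Q ΔX ΔY) k≤ (∣-∣-≤ (ΔX * ΔX) (+ s * (ΔY * ΔY))
            (∣*∣-≤ ΔX ΔX ΔX≤ ΔX≤) (∣*∣-≤ (+ s) (ΔY * ΔY) ℕₚ.≤-refl (∣*∣-≤ ΔY ΔY ΔY≤ ΔY≤))))))
        where
        2kcross≡ : + 2 * k * cross ≡ + 4 * α * ΔY + + 4 * β * ΔX + (ε₂ - ε₁) - k * Q ΔX ΔY
        2kcross≡ = begin
          + 2 * k * cross                           ≡⟨ ring k (+ s) X₁ Y₁ X₂ Y₂ ⟩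
          k * Q X₂ Y₂ - k * Q X₁ Y₁ - k * Q ΔX ΔY   ≡⟨ cong₂ (λ u v → u - v - k * Q ΔX ΔY) eq₂ eq₁ ⟩
          (+ 4 * α * Y₂ + + 4 * β * X₂ + ε₂) - (+ 4 * α * Y₁ + + 4 * β * X₁ + ε₁) - k * Q ΔX ΔY
            ≡⟨ ring′ α β X₁ Y₁ X₂ Y₂ ε₁ ε₂ (k * Q ΔX ΔY) ⟩
          + 4 * α * ΔY + + 4 * β * ΔX + (ε₂ - ε₁) - k * Q ΔX ΔY ∎
          where
          open ≡-Reasoning
          ring : ∀ k s X₁ Y₁ X₂ Y₂ → + 2 * k * (X₁ * (X₂ - X₁) - s * Y₁ * (Y₂ - Y₁)) ≡
            k * (X₂ * X₂ - s * (Y₂ * Y₂)) - k * (X₁ * X₁ - s * (Y₁ * Y₁))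
              - k * ((X₂ - X₁) * (X₂ - X₁) - s * ((Y₂ - Y₁) * (Y₂ - Y₁)))
          ring = solve-∀
          ring′ : ∀ α β X₁ Y₁ X₂ Y₂ ε₁ ε₂ z →
            (+ 4 * α * Y₂ + + 4 * β * X₂ + ε₂) - (+ 4 * α * Y₁ + + 4 * β * X₁ + ε₁) - z ≡
            + 4 * α * (Y₂ - Y₁) + + 4 * β * (X₂ - X₁) + (ε₂ - ε₁) - z
          ring′ = solve-∀
        ∣cross∣≤∣2kcross∣ : ∣ cross ∣ ℕ.≤ ∣ + 2 * k * cross ∣
        ∣cross∣≤∣2kcross∣ rewrite ∣i*j∣≡∣i∣*∣j∣ (+ 2 * k) cross | ∣i*j∣≡∣i∣*∣j∣ (+ 2) k =
          ℕₚ.m≤n*m ∣ cross ∣ (2 ℕ.* ∣ k ∣) ⦃ ℕ.>-nonZero (ℕₚ.*-mono-≤ (s≤s (z≤n {1})) 1≤k) ⦄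

      -- If Q ΔX ΔY ≠ 0 then s·y² ≤ ∣ s·Y₁²·Q ΔX ΔY ∣ = ∣ cross·(X₁·ΔX + s·Y₁·ΔY) − Q X₁ Y₁·ΔX² ∣,
      -- which is at most s·y·height-bound D.
      rigid : ∀ {y} → Y₁ ≡ + y → ∣ X₁ ∣ ℕ.≤ s ℕ.* y → ∣ Q X₁ Y₁ ∣ ℕ.≤ 8 ℕ.* s ℕ.* y →
        height-bound D ℕ.< y → Q ΔX ΔY ≡ 0ℤ
      rigid {y} Y₁≡y X₁≤ Q₁≤ big with Q ΔX ΔY ≟ 0ℤ
      ... | yes z≡0 = z≡0
      ... | no z≢0 = ⊥-elim (ℕₚ.<⇒≱ big (ℕₚ.*-cancelˡ-≤ (s ℕ.* y) ⦃ sy≢0 ⦄ (ℕₚ.≤-trans lower upper)))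
        where
        z : ℤ
        z = Q ΔX ΔY
        sy≢0 : ℕ.NonZero (s ℕ.* y)
        sy≢0 = ℕ.>-nonZero (ℕₚ.*-mono-≤ 1≤s (ℕₚ.≤-trans (s≤s z≤n) big))
        ∣Y₁∣≡y : ∣ Y₁ ∣ ≡ y
        ∣Y₁∣≡y = cong ∣_∣ Y₁≡y
        identity : + s * (Y₁ * Y₁) * z ≡ cross * (X₁ * ΔX + + s * Y₁ * ΔY) - Q X₁ Y₁ * (ΔX * ΔX)
        identity = ring (+ s) X₁ Y₁ X₂ Y₂
          where
          ring : ∀ s X₁ Y₁ X₂ Y₂ → s * (Y₁ * Y₁) * ((X₂ - X₁) * (X₂ - X₁) - s * ((Y₂ - Y₁) * (Y₂ - Y₁))) ≡
            (X₁ * (X₂ - X₁) - s * Y₁ * (Y₂ - Y₁)) * (X₁ * (X₂ - X₁) + s * Y₁ * (Y₂ - Y₁))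
              - (X₁ * X₁ - s * (Y₁ * Y₁)) * ((X₂ - X₁) * (X₂ - X₁))
          ring = solve-∀
        lower : s ℕ.* y ℕ.* y ℕ.≤ ∣ + s * (Y₁ * Y₁) * z ∣
        lower = begin
          s ℕ.* y ℕ.* y                             ≡⟨ ℕₚ.*-assoc s y y ⟩
          s ℕ.* (y ℕ.* y)                           ≡⟨ cong (λ v → s ℕ.* (v ℕ.* v)) ∣Y₁∣≡y ⟨
          s ℕ.* (∣ Y₁ ∣ ℕ.* ∣ Y₁ ∣)                  ≤⟨ ℕₚ.m≤m*n _ ∣ z ∣ ⦃ ℕ.≢-nonZero (z≢0 ∘ ∣i∣≡0⇒i≡0) ⦄ ⟩
          s ℕ.* (∣ Y₁ ∣ ℕ.* ∣ Y₁ ∣) ℕ.* ∣ z ∣        ≡⟨ cong (λ v → s ℕ.* v ℕ.* ∣ z ∣) (∣i*j∣≡∣i∣*∣j∣ Y₁ Y₁) ⟨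
          s ℕ.* ∣ Y₁ * Y₁ ∣ ℕ.* ∣ z ∣               ≡⟨ cong (ℕ._* ∣ z ∣) (∣i*j∣≡∣i∣*∣j∣ (+ s) (Y₁ * Y₁)) ⟨
          ∣ + s * (Y₁ * Y₁) ∣ ℕ.* ∣ z ∣             ≡⟨ ∣i*j∣≡∣i∣*∣j∣ (+ s * (Y₁ * Y₁)) z ⟨
          ∣ + s * (Y₁ * Y₁) * z ∣                   ∎
          where open ℕₚ.≤-Reasoning
        upper : ∣ + s * (Y₁ * Y₁) * z ∣ ℕ.≤ s ℕ.* y ℕ.* height-bound D
        upper rewrite identity = ℕₚ.≤-trans
          (∣-∣-≤ (cross * (X₁ * ΔX + + s * Y₁ * ΔY)) (Q X₁ Y₁ * (ΔX * ΔX))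
            (∣*∣-≤ cross (X₁ * ΔX + + s * Y₁ * ΔY) ∣cross∣≤
              (∣+∣-≤ (X₁ * ΔX) (+ s * Y₁ * ΔY) (∣*∣-≤ X₁ ΔX X₁≤ ΔX≤)
                (∣*∣-≤ (+ s * Y₁) ΔY (∣*∣-≤ (+ s) Y₁ ℕₚ.≤-refl (ℕₚ.≤-reflexive ∣Y₁∣≡y)) ΔY≤)))
            (∣*∣-≤ (Q X₁ Y₁) (ΔX * ΔX) Q₁≤ (∣*∣-≤ ΔX ΔX ΔX≤ ΔX≤)))
          (ℕₚ.≤-reflexive (ring (cross-bound D) s y D))
          where
          ring : ∀ A s y D → A ℕ.* (s ℕ.* y ℕ.* D ℕ.+ s ℕ.* y ℕ.* D) ℕ.+ 8 ℕ.* s ℕ.* y ℕ.* (D ℕ.* D) ≡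
            s ℕ.* y ℕ.* (A ℕ.* (D ℕ.+ D) ℕ.+ 8 ℕ.* (D ℕ.* D))
          ring = ℕ-Ring.solve-∀

module Resonance where

  open IntegerBounds
  open LinearForms using (ints; ∈-ints)
  open Triangular
  open NonSquare
  open Conic
  open import Data.Nat as ℕ using (ℕ; z≤n; s≤s; _^_)
  import Data.Nat.Properties as ℕₚ
  import Data.Nat.Tactic.RingSolver as ℕ-Ring
  open import Data.Integer using (ℤ; +_; ∣_∣; _+_; _*_; -_; _-_; 0ℤ; 1ℤ)
  open import Data.Integer.Properties using (i-j≡0⇒i≡j; pos-+; pos-*; +-injective)
  open import Data.Integer.Tactic.RingSolver using (solve-∀)
  open import Data.List using (List; []; _∷_; length; cartesianProduct)
  open import Data.List.Relation.Unary.All as All using (All; []; _∷_)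
  open import Data.List.Membership.Propositional.Properties using (∈-cartesianProduct⁺)
  open import Data.Product using (∃; _×_; _,_; proj₁)
  open import Data.Empty using (⊥; ⊥-elim)
  open import Relation.Nullary using (¬_; Dec; yes; no; _×-dec_)
  open import Relation.Binary.PropositionalEquality
    using (_≡_; refl; sym; trans; cong; cong₂; subst; module ≡-Reasoning)

  +odd : ∀ a → + (2 ℕ.* a ℕ.+ 1) ≡ + 2 * + a + 1ℤ
  +odd a = trans (pos-+ (2 ℕ.* a) 1) (cong (_+ 1ℤ) (pos-* 2 a))

  odd-difference : ∀ {a b} → a ℕ.≤ b → + (2 ℕ.* b ℕ.+ 1) - + (2 ℕ.* a ℕ.+ 1) ≡ + (2 ℕ.* (b ℕ.∸ a))
  odd-difference {a} {b} a≤b = begin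
    + (2 ℕ.* b ℕ.+ 1) - + (2 ℕ.* a ℕ.+ 1)  ≡⟨ cong₂ _-_ (+odd b) (+odd a) ⟩
    + 2 * + b + 1ℤ - (+ 2 * + a + 1ℤ)      ≡⟨ ring (+ a) (+ b) ⟩
    + 2 * (+ b - + a)                     ≡⟨ cong (+ 2 *_) (+-∸ a≤b) ⟩
    + 2 * + (b ℕ.∸ a)                     ≡⟨ pos-* 2 (b ℕ.∸ a) ⟨
    + (2 ℕ.* (b ℕ.∸ a))                   ∎
    where
    open ≡-Reasoning
    ring : ∀ a b → + 2 * b + 1ℤ - (+ 2 * a + 1ℤ) ≡ + 2 * (b - a)
    ring = solve-∀

  half-≤ : ∀ {P W} → 2 ℕ.* P ℕ.≤ W → P ℕ.≤ W
  half-≤ {P} 2P≤W = ℕₚ.≤-trans (ℕₚ.m≤m+n P _) 2P≤W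

  halves : ∀ n P → n ℕ.+ P ℕ.+ P ≡ n ℕ.+ 2 ℕ.* P
  halves = ℕ-Ring.solve-∀

  module OrbitConic {s : ℕ} (1≤s : 1 ℕ.≤ s) where

    open Orbit s 1≤s

    X Y : ℕ → ℤ
    X n = + (2 ℕ.* diag n ℕ.+ 1)
    Y n = + (2 ℕ.* n ℕ.+ 1)

    pell : ∀ n → X n * X n - + s * (Y n * Y n) ≡ 1ℤ - + s - + 8 * + offset n
    pell n = begin
      X n * X n - + s * (Y n * Y n)
        ≡⟨ cong₂ (λ u v → u - + s * v) (sym (pos-* (2 ℕ.* diag n ℕ.+ 1) _)) (sym (pos-* (2 ℕ.* n ℕ.+ 1) _)) ⟩
      + ((2 ℕ.* diag n ℕ.+ 1) ℕ.* (2 ℕ.* diag n ℕ.+ 1)) - + s * + ((2 ℕ.* n ℕ.+ 1) ℕ.* (2 ℕ.* n ℕ.+ 1))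
        ≡⟨ cong₂ (λ u v → + u - + s * + v) (odd-square (diag n)) (odd-square n) ⟩
      + (8 ℕ.* tri (diag n) ℕ.+ 1) - + s * + (8 ℕ.* tri n ℕ.+ 1)
        ≡⟨ cong₂ (λ u v → u - + s * v) (eight (tri (diag n))) (eight (tri n)) ⟩
      + 8 * + tri (diag n) + 1ℤ - + s * (+ 8 * + tri n + 1ℤ)
        ≡⟨ ring (+ tri (diag n)) (+ offset n) (+ s) (+ tri n) ⟩
      + 8 * ((+ tri (diag n) + + offset n) - + s * + tri n) + 1ℤ - + s - + 8 * + offset n
        ≡⟨ cong (λ z → + 8 * (z - + s * + tri n) + 1ℤ - + s - + 8 * + offset n) balance ⟩
      + 8 * (+ s * + tri n - + s * + tri n) + 1ℤ - + s - + 8 * + offset n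
        ≡⟨ ring′ (+ s * + tri n) (+ s) (+ offset n) ⟩
      1ℤ - + s - + 8 * + offset n ∎
      where
      open ≡-Reasoning
      eight : ∀ t → + (8 ℕ.* t ℕ.+ 1) ≡ + 8 * + t + 1ℤ
      eight t = trans (pos-+ (8 ℕ.* t) 1) (cong (_+ 1ℤ) (pos-* 8 t))
      balance : + tri (diag n) + + offset n ≡ + s * + tri n
      balance = trans (sym (pos-+ (tri (diag n)) (offset n))) (trans (cong +_ (tri-diag+offset n)) (pos-* s (tri n)))
      ring : ∀ A R S T → + 8 * A + 1ℤ - S * (+ 8 * T + 1ℤ) ≡ + 8 * ((A + R) - S * T) + 1ℤ - S - + 8 * R
      ring = solve-∀
      ring′ : ∀ P S R → + 8 * (P - P) + 1ℤ - S - + 8 * R ≡ 1ℤ - S - + 8 * R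
      ring′ = solve-∀

    ∣X∣≤ : ∀ n → ∣ X n ∣ ℕ.≤ s ℕ.* (2 ℕ.* n ℕ.+ 1)
    ∣X∣≤ n = subst (2 ℕ.* diag n ℕ.+ 1 ℕ.≤_) (ring s n) (ℕₚ.+-mono-≤ (ℕₚ.*-monoʳ-≤ 2 (diag≤s*n n)) 1≤s)
      where
      ring : ∀ s n → 2 ℕ.* (s ℕ.* n) ℕ.+ s ≡ s ℕ.* (2 ℕ.* n ℕ.+ 1)
      ring = ℕ-Ring.solve-∀

    ∣pell∣≤ : ∀ n → ∣ X n * X n - + s * (Y n * Y n) ∣ ℕ.≤ 8 ℕ.* s ℕ.* (2 ℕ.* n ℕ.+ 1)
    ∣pell∣≤ n rewrite pell n = ℕₚ.≤-trans
      (∣-∣-≤ (1ℤ - + s) (+ 8 * + offset n)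
        (∣-∣-≤ 1ℤ (+ s) ℕₚ.≤-refl ℕₚ.≤-refl) (∣*∣-≤ (+ 8) (+ offset n) ℕₚ.≤-refl ℕₚ.≤-refl))
      (subst (1 ℕ.+ s ℕ.+ 8 ℕ.* offset n ℕ.≤_) (ring s n)
        (ℕₚ.+-mono-≤ (ℕₚ.+-mono-≤ (ℕₚ.≤-trans 1≤s (ℕₚ.m≤m*n s 7)) (ℕₚ.≤-refl {s}))
          (ℕₚ.*-monoʳ-≤ 8 (ℕₚ.≤-trans (offset≤diag n) (ℕₚ.≤-trans (diag≤s*n n) (ℕₚ.m≤m+n (s ℕ.* n) (s ℕ.* n)))))))
      where
      ring : ∀ s n → s ℕ.* 7 ℕ.+ s ℕ.+ 8 ℕ.* (s ℕ.* n ℕ.+ s ℕ.* n) ≡ 8 ℕ.* s ℕ.* (2 ℕ.* n ℕ.+ 1)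
      ring = ℕ-Ring.solve-∀

    ∣ΔX∣≤ : ∀ W {n₁ n₂} → n₁ ℕ.≤ n₂ → n₂ ℕ.≤ n₁ ℕ.+ W → ∣ X n₂ - X n₁ ∣ ℕ.≤ 2 ℕ.* gap W
    ∣ΔX∣≤ W {n₁} {n₂} n₁≤n₂ n₂≤ rewrite odd-difference (diag-mono-≤ n₁≤n₂) =
      ℕₚ.*-monoʳ-≤ 2 (ℕₚ.m≤n+o⇒m∸n≤o (diag n₂) (diag n₁) (diag-gap W n₁≤n₂ n₂≤))

    ∣ΔY∣≤ : ∀ W {n₁ n₂} → n₁ ℕ.≤ n₂ → n₂ ℕ.≤ n₁ ℕ.+ W → ∣ Y n₂ - Y n₁ ∣ ℕ.≤ 2 ℕ.* gap W
    ∣ΔY∣≤ W {n₁} {n₂} n₁≤n₂ n₂≤ rewrite odd-difference n₁≤n₂ =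
      ℕₚ.*-monoʳ-≤ 2 (ℕₚ.≤-trans (ℕₚ.m≤n+o⇒m∸n≤o n₂ n₁ n₂≤) W≤gap)
      where
      W≤gap : W ℕ.≤ gap W
      W≤gap = ℕₚ.≤-trans (ℕₚ.≤-trans (ℕₚ.≤-reflexive (sym (ℕₚ.*-identityˡ W))) (ℕₚ.*-monoˡ-≤ W 1≤s)) (ℕₚ.m≤m+n _ _)

  module GoodPoint {s : ℕ} (1≤s : 1 ℕ.≤ s) (s-nonsquare : ¬ IsSquare s) (C Nst : ℕ) where

    open Orbit s 1≤s
    open OrbitConic 1≤s

    value : Coeffs → ℕ → ℤ
    value (α , β , k) n = α * + n + β * + diag n + k * + offset n

    Resonant : Coeffs → ℕ → Set
    Resonant τ n = Admissible C τ × ∣ value τ n ∣ ℕ.≤ Nst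

    resonant? : ∀ τ n → Dec (Resonant τ n)
    resonant? τ@(α , β , k) n =
      ((∣ α ∣ ℕ.≤? C) ×-dec (∣ β ∣ ℕ.≤? C) ×-dec (1 ℕ.≤? ∣ k ∣) ×-dec (∣ k ∣ ℕ.≤? C ℕ.+ C))
        ×-dec (∣ value τ n ∣ ℕ.≤? Nst)

    error-bound : ℕ
    error-bound = (C ℕ.+ C) ℕ.* (1 ℕ.+ s) ℕ.+ 4 ℕ.* C ℕ.+ 4 ℕ.* C ℕ.+ 8 ℕ.* Nst

    open Rigidity 1≤s C error-bound using (Q; Near; height-bound; rigid)

    near : ∀ {α β k} n → Resonant (α , β , k) n → Near α β k (X n) (Y n)
    near {α} {β} {k} n ((α≤ , β≤ , _ , k≤) , v≤) = record
      { ε = ε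
      ; ε≤ = ∣-∣-≤ (k * (1ℤ - + s) - + 4 * α - + 4 * β) (+ 8 * v)
               (∣-∣-≤ (k * (1ℤ - + s) - + 4 * α) (+ 4 * β)
                 (∣-∣-≤ (k * (1ℤ - + s)) (+ 4 * α)
                   (∣*∣-≤ k (1ℤ - + s) k≤ (∣-∣-≤ 1ℤ (+ s) ℕₚ.≤-refl ℕₚ.≤-refl))
                   (∣*∣-≤ (+ 4) α ℕₚ.≤-refl α≤))
                 (∣*∣-≤ (+ 4) β ℕₚ.≤-refl β≤))
               (∣*∣-≤ (+ 8) v ℕₚ.≤-refl v≤)
      ; equation = begin
          k * Q (X n) (Y n)                   ≡⟨ cong (k *_) (pell n) ⟩
          k * (1ℤ - + s - + 8 * + offset n)   ≡⟨ ring α β k (+ s) (+ n) (+ diag n) (+ offset n) ⟩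
          + 4 * α * (+ 2 * + n + 1ℤ) + + 4 * β * (+ 2 * + diag n + 1ℤ) + ε
            ≡⟨ cong₂ (λ u w → + 4 * α * u + + 4 * β * w + ε) (+odd n) (+odd (diag n)) ⟨
          + 4 * α * Y n + + 4 * β * X n + ε   ∎
      }
      where
      open ≡-Reasoning
      v ε : ℤ
      v = value (α , β , k) n
      ε = k * (1ℤ - + s) - + 4 * α - + 4 * β - + 8 * v
      ring : ∀ α β k s n m r → k * (1ℤ - s - + 8 * r) ≡
        + 4 * α * (+ 2 * n + 1ℤ) + + 4 * β * (+ 2 * m + 1ℤ) + (k * (1ℤ - s) - + 4 * α - + 4 * β - + 8 * (α * n + β * m + k * r))
      ring = solve-∀

    period-bound : ℕ → ℕ
    period-bound W = height-bound (2 ℕ.* gap W)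

    no-double-resonance : ∀ W τ {n₁ n₂} → Resonant τ n₁ → Resonant τ n₂ → n₁ ℕ.< n₂ → n₂ ℕ.≤ n₁ ℕ.+ W →
      period-bound W ℕ.≤ n₁ → ⊥
    no-double-resonance W (α , β , k) {n₁} {n₂} res₁ res₂ n₁<n₂ n₂≤ big =
      s-nonsquare (square-ratio s Δx Δy ⦃ Δy≢0 ⦄ (+-injective (begin
        + (Δx ℕ.* Δx)                        ≡⟨ pos-* Δx Δx ⟩
        + Δx * + Δx                          ≡⟨ cong₂ _*_ (odd-difference m₁≤m₂) (odd-difference m₁≤m₂) ⟨
        (X n₂ - X n₁) * (X n₂ - X n₁)        ≡⟨ i-j≡0⇒i≡j _ _ Q[ΔX,ΔY]≡0 ⟩
        + s * ((Y n₂ - Y n₁) * (Y n₂ - Y n₁)) ≡⟨ cong₂ (λ u v → + s * (u * v)) (odd-difference n₁≤n₂) (odd-difference n₁≤n₂) ⟩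
        + s * (+ Δy * + Δy)                  ≡⟨ cong (+ s *_) (pos-* Δy Δy) ⟨
        + s * + (Δy ℕ.* Δy)                  ≡⟨ pos-* s (Δy ℕ.* Δy) ⟨
        + (s ℕ.* (Δy ℕ.* Δy))                ∎)))
      where
      open ≡-Reasoning
      n₁≤n₂ : n₁ ℕ.≤ n₂
      n₁≤n₂ = ℕₚ.<⇒≤ n₁<n₂
      m₁≤m₂ : diag n₁ ℕ.≤ diag n₂
      m₁≤m₂ = diag-mono-≤ n₁≤n₂
      Δx Δy : ℕ
      Δx = 2 ℕ.* (diag n₂ ℕ.∸ diag n₁)
      Δy = 2 ℕ.* (n₂ ℕ.∸ n₁)
      Δy≢0 : ℕ.NonZero Δy
      Δy≢0 = ℕ.>-nonZero (ℕₚ.≤-trans (ℕₚ.m<n⇒0<n∸m n₁<n₂) (ℕₚ.m≤m+n _ _))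
      Q[ΔX,ΔY]≡0 : Q (X n₂ - X n₁) (Y n₂ - Y n₁) ≡ 0ℤ
      Q[ΔX,ΔY]≡0 = rigid {α} {β} {k} (proj₁ res₁) (2 ℕ.* gap W) (near n₁ res₁) (near n₂ res₂)
        (∣ΔX∣≤ W n₁≤n₂ n₂≤) (∣ΔY∣≤ W n₁≤n₂ n₂≤) refl (∣X∣≤ n₁) (∣pell∣≤ n₁)
        (ℕₚ.≤-<-trans big (ℕₚ.≤-<-trans (ℕₚ.m≤m+n n₁ (n₁ ℕ.+ 0)) (ℕₚ.m<m+n _ (s≤s z≤n))))

    -- Splitting a window of length 2P into two halves of length P: a coefficient vector
    -- resonating at the chosen points of both halves would resonate twice within the window.
    window : ∀ W (L : List Coeffs) n₀ → period-bound W ℕ.≤ n₀ → 2 ^ length L ℕ.≤ W →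
      ∃ λ n → n₀ ℕ.≤ n × n ℕ.< n₀ ℕ.+ 2 ^ length L × All (λ τ → ¬ Resonant τ n) L
    window W [] n₀ _ _ = n₀ , ℕₚ.≤-refl , ℕₚ.m<m+n n₀ (s≤s z≤n) , []
    window W (τ ∷ L) n₀ big 2P≤W
      with window W L n₀ big (half-≤ 2P≤W)
         | window W L (n₀ ℕ.+ 2 ^ length L) (ℕₚ.≤-trans big (ℕₚ.m≤m+n n₀ _)) (half-≤ 2P≤W)
    ... | n₁ , n₀≤n₁ , n₁< , quiet₁ | n₂ , n₀+P≤n₂ , n₂< , quiet₂ with resonant? τ n₁ | resonant? τ n₂
    ... | no ¬res₁ | _ =
      n₁ , n₀≤n₁ , ℕₚ.<-≤-trans n₁< (ℕₚ.+-monoʳ-≤ n₀ (ℕₚ.m≤m+n (2 ^ length L) _)) , ¬res₁ ∷ quiet₁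
    ... | yes _ | no ¬res₂ =
      n₂ , ℕₚ.≤-trans (ℕₚ.m≤m+n n₀ _) n₀+P≤n₂ , subst (n₂ ℕ.<_) (halves n₀ (2 ^ length L)) n₂< , ¬res₂ ∷ quiet₂
    ... | yes res₁ | yes res₂ = ⊥-elim (no-double-resonance W τ res₁ res₂ (ℕₚ.<-≤-trans n₁< n₀+P≤n₂)
      (ℕₚ.≤-trans (ℕₚ.<⇒≤ n₂<) (ℕₚ.≤-trans (ℕₚ.≤-reflexive (halves n₀ (2 ^ length L))) (ℕₚ.+-mono-≤ n₀≤n₁ 2P≤W)))
      (ℕₚ.≤-trans big n₀≤n₁))

    coeffs : List Coeffs
    coeffs = cartesianProduct (ints C) (cartesianProduct (ints C) (ints (C ℕ.+ C)))

    good-point : ∃ λ n → ∀ τ → Admissible C τ → Nst ℕ.< ∣ value τ n ∣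
    good-point with window (2 ^ length coeffs) coeffs (period-bound (2 ^ length coeffs)) ℕₚ.≤-refl ℕₚ.≤-refl
    ... | n , _ , _ , quiet = n , λ where
      τ@(α , β , k) adm@(α≤ , β≤ , _ , k≤) → ℕₚ.≰⇒> λ v≤ →
        All.lookup quiet (∈-cartesianProduct⁺ (∈-ints α α≤) (∈-cartesianProduct⁺ (∈-ints β β≤) (∈-ints k k≤))) (adm , v≤)

module Construction where

  open IntegerBounds
  open LinearForms
  open Agreement
  open Similarity
  open Transfer
  open Triangular
  open Conic using (Admissible)
  open Resonance
  open import Data.Nat as ℕ using (ℕ; zero; suc; z≤n; s≤s)
  import Data.Nat.Properties as ℕₚ
  open import Data.Integer using (ℤ; +_; ∣_∣; _+_; _*_; -_; _-_; 0ℤ; 1ℤ; -1ℤ)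
  open import Data.Integer.Properties using (pos-+; +-identityʳ; +-inverseʳ; *-identityˡ; ∣i∣≡0⇒i≡0; i-j≡0⇒i≡j; _≟_)
  open import Data.Integer.Tactic.RingSolver using (solve-∀)
  open import Data.Fin using (Fin; zero; suc)
  open import Data.Vec using ([]; _∷_)
  open import Data.Vec.Relation.Unary.All using ([]; _∷_)
  open import Data.Product using (_,_; proj₁; proj₂)
  open import Function using (_∘_)
  open import Function.Bundles using (Equivalence)
  open import Relation.Nullary using (¬_; yes; no)
  open import Relation.Binary.PropositionalEquality
    using (_≡_; refl; sym; trans; cong; subst; module ≡-Reasoning)

  nonsquare-positive : ∀ {s} → ¬ IsSquare s → 1 ℕ.≤ s
  nonsquare-positive {zero} s-nonsquare with () ← s-nonsquare (0 , refl)
  nonsquare-positive {suc s} _ = s≤s z≤n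

  module Witness {s : ℕ} (s-nonsquare : ¬ IsSquare s) (B k : ℕ) where

    open ≡-Reasoning

    1≤s : 1 ℕ.≤ s
    1≤s = nonsquare-positive s-nonsquare
    open Orbit s 1≤s
    open Precision (level B k) renaming (width to C; threshold to N; modulus to M)

    -- Moving ρ to ρ' changes a form of width C by at most (C + C)·M.
    Nst : ℕ
    Nst = (C ℕ.+ C) ℕ.* M ℕ.+ N

    open GoodPoint 1≤s s-nonsquare C Nst using (value; good-point)

    n m r : ℕ
    n = proj₁ good-point
    m = diag n
    r = offset n

    beyond : ∀ τ → Admissible C τ → Nst ℕ.< ∣ value τ n ∣
    beyond = proj₂ good-point

    1≤M : 1 ℕ.≤ M
    1≤M = modulus-≥1 B k

    M<r : M ℕ.< r
    M<r = ℕₚ.≤-<-trans M≤Nst (subst (Nst ℕ.<_) ∣value∣≡r (beyond (0ℤ , 0ℤ , 1ℤ) (z≤n , z≤n , ℕₚ.≤-refl , 1≤C+C)))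
      where
      1≤C+C : 1 ℕ.≤ C ℕ.+ C
      1≤C+C = ℕₚ.≤-trans (ℕₚ.≤-trans (s≤s z≤n) (width-≥ B k)) (ℕₚ.m≤m+n C C)
      M≤Nst : M ℕ.≤ Nst
      M≤Nst = ℕₚ.≤-trans (ℕₚ.m≤n*m M (C ℕ.+ C) ⦃ ℕ.>-nonZero 1≤C+C ⦄) (ℕₚ.m≤m+n _ N)
      ∣value∣≡r : ∣ value (0ℤ , 0ℤ , 1ℤ) n ∣ ≡ r
      ∣value∣≡r = cong ∣_∣ (ring (+ n) (+ m) (+ r))
        where
        ring : ∀ n m r → 0ℤ * n + 0ℤ * m + 1ℤ * r ≡ r
        ring = solve-∀

    -- ρ is (n , 0 , f (n , 0)); ρ' moves the image point by M along its Cantor diagonal.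
    ρ ρ' : Env 4
    ρ = env4 n 0 (m ℕ.∸ r) r
    ρ' = env4 n 0 (m ℕ.∸ r ℕ.+ M) (r ℕ.∸ M)

    shift : Fin 4 → ℤ
    shift zero = 0ℤ
    shift (suc zero) = 0ℤ
    shift (suc (suc zero)) = 1ℤ
    shift (suc (suc (suc zero))) = -1ℤ

    congruent : ∀ i → + ρ' i ≡ + ρ i + shift i * + M
    congruent zero = sym (+-identityʳ (+ n))
    congruent (suc zero) = refl
    congruent (suc (suc zero)) = trans (pos-+ (m ℕ.∸ r) M) (cong (_+_ (+ (m ℕ.∸ r))) (sym (*-identityˡ (+ M))))
    congruent (suc (suc (suc zero))) = trans (sym (+-∸ (ℕₚ.<⇒≤ M<r))) (ring (+ r) (+ M))
      where
      ring : ∀ r M → r - M ≡ r + -1ℤ * M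
      ring = solve-∀

    agree : ∀ c → Bounded C c → Agree N (c · ρ) (c · ρ')
    agree c@(c₁ ∷ c₂ ∷ c₃ ∷ c₄ ∷ []) (c₁≤ ∷ c₂≤ ∷ c₃≤ ∷ c₄≤ ∷ []) =
      subst (Agree N (c · ρ)) (sym ·ρ'≡) agree-shifted
      where
      ·ρ'≡ : c · ρ' ≡ c · ρ + (c₃ - c₄) * + M
      ·ρ'≡ = trans (⊙-shift c (+_ ∘ ρ) (+_ ∘ ρ') shift (+ M) congruent) (cong (λ z → c · ρ + z * + M) (ring c₁ c₂ c₃ c₄))
        where
        ring : ∀ c₁ c₂ c₃ c₄ → c₁ * 0ℤ + (c₂ * 0ℤ + (c₃ * 1ℤ + (c₄ * -1ℤ + 0ℤ))) ≡ c₃ - c₄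
        ring = solve-∀
      ·ρ≡ : c · ρ ≡ value (c₁ , c₃ , c₄ - c₃) n
      ·ρ≡ = trans (cong (λ z → c₁ * + n + (c₂ * + 0 + (c₃ * z + (c₄ * + r + 0ℤ)))) (sym (+-∸ (offset≤diag n))))
        (ring c₁ c₂ c₃ c₄ (+ n) (+ m) (+ r))
        where
        ring : ∀ c₁ c₂ c₃ c₄ n m r →
          c₁ * n + (c₂ * + 0 + (c₃ * (m - r) + (c₄ * r + 0ℤ))) ≡ c₁ * n + c₃ * m + (c₄ - c₃) * r
        ring = solve-∀
      agree-shifted : Agree N (c · ρ) (c · ρ + (c₃ - c₄) * + M)
      agree-shifted with c₃ ≟ c₄
      ... | yes refl = subst (Agree N (c · ρ)) (sym (trans (cong (λ z → c · ρ + z * + M) (+-inverseʳ c₃)) (+-identityʳ (c · ρ)))) equal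
      ... | no c₃≢c₄ = Agree-shift (c · ρ) ((c₃ - c₄) * + M)
        (subst (λ v → Nst ℕ.< ∣ v ∣) (sym ·ρ≡)
          (beyond (c₁ , c₃ , c₄ - c₃) (c₁≤ , c₃≤ , 1≤∣c₄-c₃∣ , ∣-∣-≤ c₄ c₃ c₄≤ c₃≤)))
        (∣*∣-≤ (c₃ - c₄) (+ M) (∣-∣-≤ c₃ c₄ c₃≤ c₄≤) ℕₚ.≤-refl)
        where
        1≤∣c₄-c₃∣ : 1 ℕ.≤ ∣ c₄ - c₃ ∣
        1≤∣c₄-c₃∣ = ℕₚ.n≢0⇒n>0 λ ∣c₄-c₃∣≡0 →
          c₃≢c₄ (sym (i-j≡0⇒i≡j c₄ c₃ (∣i∣≡0⇒i≡0 ∣c₄-c₃∣≡0)))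

    similar : Sim (level B k) ρ ρ'
    similar = record { shift = shift ; congruent = congruent ; agree = agree }

    C₁-along-diagonal : ∀ d → d ℕ.≤ r → C₁ (m ℕ.∸ r ℕ.+ d) (r ℕ.∸ d) ≡ tri m ℕ.+ (r ℕ.∸ d)
    C₁-along-diagonal d d≤r = trans (C₁≡tri (m ℕ.∸ r ℕ.+ d) (r ℕ.∸ d)) (cong (λ z → tri z ℕ.+ (r ℕ.∸ d)) diagonal)
      where
      diagonal : m ℕ.∸ r ℕ.+ d ℕ.+ (r ℕ.∸ d) ≡ m
      diagonal = begin
        m ℕ.∸ r ℕ.+ d ℕ.+ (r ℕ.∸ d)     ≡⟨ ℕₚ.+-assoc (m ℕ.∸ r) d (r ℕ.∸ d) ⟩
        m ℕ.∸ r ℕ.+ (d ℕ.+ (r ℕ.∸ d))   ≡⟨ cong (m ℕ.∸ r ℕ.+_) (ℕₚ.m+[n∸m]≡n d≤r) ⟩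
        m ℕ.∸ r ℕ.+ r                   ≡⟨ ℕₚ.m∸n+n≡m (offset≤diag n) ⟩
        m                               ∎

    s·C₁[n,0]≡ : s ℕ.* C₁ n 0 ≡ tri m ℕ.+ r
    s·C₁[n,0]≡ = begin
      s ℕ.* C₁ n 0                 ≡⟨ cong (s ℕ.*_) (C₁≡tri n 0) ⟩
      s ℕ.* (tri (n ℕ.+ 0) ℕ.+ 0)  ≡⟨ cong (s ℕ.*_) (trans (ℕₚ.+-identityʳ _) (cong tri (ℕₚ.+-identityʳ n))) ⟩
      s ℕ.* tri n                  ≡⟨ tri-diag+offset n ⟨
      tri m ℕ.+ r                  ∎

    in-graph : GraphF zero s n 0 (m ℕ.∸ r) r
    in-graph = begin
      C₁ (m ℕ.∸ r) r                ≡⟨ cong (λ x → C₁ x r) (ℕₚ.+-identityʳ (m ℕ.∸ r)) ⟨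
      C₁ (m ℕ.∸ r ℕ.+ 0) (r ℕ.∸ 0)  ≡⟨ C₁-along-diagonal 0 z≤n ⟩
      tri m ℕ.+ r                   ≡⟨ s·C₁[n,0]≡ ⟨
      s ℕ.* C₁ n 0                  ∎

    off-graph : ¬ GraphF zero s n 0 (m ℕ.∸ r ℕ.+ M) (r ℕ.∸ M)
    off-graph on-graph = ℕₚ.<-irrefl r∸M≡r (ℕₚ.∸-monoʳ-< 1≤M (ℕₚ.<⇒≤ M<r))
      where
      r∸M≡r : r ℕ.∸ M ≡ r
      r∸M≡r = ℕₚ.+-cancelˡ-≡ (tri m) (r ℕ.∸ M) r (begin
        tri m ℕ.+ (r ℕ.∸ M)             ≡⟨ C₁-along-diagonal M (ℕₚ.<⇒≤ M<r) ⟨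
        C₁ (m ℕ.∸ r ℕ.+ M) (r ℕ.∸ M)    ≡⟨ on-graph ⟩
        s ℕ.* C₁ n 0                    ≡⟨ s·C₁[n,0]≡ ⟩
        tri m ℕ.+ r                     ∎)

  graph-undefinable : ∀ {s} → ¬ IsSquare s → ¬ Definable4 (GraphF zero s)
  graph-undefinable s-nonsquare (φ , R⇔φ) =
    off-graph (Equivalence.from (R⇔φ _ _ _ _) (transfer φ ℕₚ.≤-refl ℕₚ.≤-refl similar (Equivalence.to (R⇔φ _ _ _ _) in-graph)))
    where
    open Witness s-nonsquare (size φ) (rank φ)

open Construction using (graph-undefinable)
open Renaming using (Definable4-swap)
open import Data.Fin using (zero; suc)
open import Function using (_∘_)

theorem13 : (s : ℕ) → ¬ IsSquare s → (i : Fin 2) →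
    ¬ Definable4 (GraphF i s)
theorem13 s s-nonsquare zero = graph-undefinable s-nonsquare
theorem13 s s-nonsquare (suc zero) = graph-undefinable s-nonsquare ∘ Definable4-swap
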